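{- Let $\ell\in\mathbb{N}$ and $\mathbf{s}=(\{2\}^{a_1},c_1,\dots,\{2\}^{a_\ell},c_\ell,\{2\}^{a_{\ell+1}})$ with $a_j,c_j\in\mathbb{N}_0$ and $c_j\ge3$ for all $j$. Then for every positive integer $n$, $$H_n^\star[\mathbf{s}]=-\sum_{(\mathbf{p};\tilde{\mathbf{p}};\tilde{\tilde{\mathbf{p}}})\in\Pi(\mathbf{s})}\mathcal{H}_n[\mathbf{p};\tilde{\mathbf{p}};\tilde{\tilde{\mathbf{p}}}],$$ where $\Pi(\mathbf{s})$ is the set $$\{\overline{2a_1+2}\circ1^{\circ(c_1-3)}\circ(2a_2+3)\circ1^{\circ(c_2-3)}\circ\cdots\circ(2a_\ell+3)\circ1^{\circ(c_\ell-3)}\circ(2a_{\ell+1}+1);$$ $$(a_1+1)\circ0^{\circ(c_1-3)}\circ\cdots\circ(a_\ell+1)\circ0^{\circ(c_\ell-3)}\circ a_{\ell+1};\ 1\circ\theta^{\circ(c_1-2)}\circ\cdots\circ\theta^{\circ(c_\ell-2)}\}.$$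
   Context: Fix $0<q<1$. $[k]=(1-q^k)/(1-q)$; $(x;q)_n=\prod_{i=0}^{n-1}(1-xq^i)$; $\binom{n}{k}_q=(q;q)_n/((q;q)_k(q;q)_{n-k})$ for $0\le k\le n$, else $0$. $\{x\}^a$ denotes $a$ copies of $x$. Signed numbers: $\mathbb{D}_0=\mathbb{N}_0\cup\{\bar k:k\in\mathbb{N}_0\}$ ($\bar k$ a formal symbol), $|k|=|\bar k|=k$, $\operatorname{sgn}(k)=1$, $\operatorname{sgn}(\bar k)=-1$; $a\oplus b=\overline{|a|+|b|}$ if exactly one of $a,b$ is unbarred, $a+b$ if both unbarred, $|a|+|b|$ if both barred. For $\mathbf{s}\in\mathbb{D}_0^m$: $H_n^\star[\mathbf{s}]=\sum_{n\ge k_1\ge\cdots\ge k_m\ge1}\prod_{j}\operatorname{sgn}(s_j)^{k_j}q^{k_j}/[k_j]^{|s_j|}$. $\theta$ is a formal symbol; $Q(r,k)=rk(k-1)/2$ if $r\in\mathbb{Z},r>0$; $Q(r,k)=rk(k-1)/2-k$ if $r\in\mathbb{Z},r\le0$; $Q(\theta,k)=0$. On $\mathbb{Z}\cup\{\theta\}$: $\theta\boxplus a=a\boxplus\theta=a$; $a\boxplus b=a+b$ for integers with $(a,b)\neq(1,-1),(-1,1)$; $1\boxplus(-1)=\theta$, $(-1)\boxplus1=0$; iterated $\boxplus$ evaluated left to right. For $\mathbf{s}\in\mathbb{D}_0^m$, $\mathbf{t}\in\mathbb{N}_0^m$, $\mathbf{r}\in(\mathbb{Z}\cup\{\theta\})^m$,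 $m\ge1$: $$\mathcal{H}_n[\mathbf{s};\mathbf{t};\mathbf{r}]=\sum_{n\ge k_1>\cdots>k_m\ge1}\frac{\binom{n}{k_1}_q}{\binom{n+k_1}{k_1}_q}\prod_{j=1}^m\frac{\operatorname{sgn}(s_j)^{k_j}q^{t_jk_j+Q(r_j,k_j)}(1+q^{k_j})}{[k_j]^{|s_j|}}.$$ Merging notation: the set $\{x_1\circ\cdots\circ x_N;y_1\circ\cdots\circ y_N;z_1\circ\cdots\circ z_N\}$ consists of the triples obtained from all $2^{N-1}$ choices, for each of the $N-1$ gaps, of a comma or a merge (same choice in all three strings); each maximal run of merged entries becomes one entry: its $\oplus$-sum in the first string, ordinary sum in the second, $\boxplus$-combination in the third; sums over such a set run over all $2^{N-1}$ choices. $x^{\circ k}$ means $k$ copies of $x$ separated by $\circ$ (empty if $k=0$, with the adjoining $\circ$ dropped).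
   Formalization: The parameter q is a rational number with $0<q<1$. -}

module Defs where

open import Data.Nat as ℕ using (ℕ; zero; suc; _∸_)
open import Data.Integer as ℤ using (ℤ; +_; -[1+_])
open import Data.Rational as ℚ using (ℚ; 0ℚ; 1ℚ; 1/_; ≢-nonZero)
open import Data.Rational.Properties using (_≟_)
open import Data.List using (List; []; _∷_; _++_; map; replicate; concat; zip)
open import Data.Product using (_×_; _,_)
open import Relation.Nullary using (yes; no)

-- total inverse; only ever applied to nonzero values in the statement
inv : ℚ → ℚ
inv p with p ≟ 0ℚ
... | yes _  = 0ℚ
... | no p≢0 = 1/_ p {{≢-nonZero p≢0}}

pow : ℚ → ℕ → ℚ
pow x zero    = 1ℚ
pow x (suc n) = x ℚ.* pow x n

powℤ : ℚ → ℤ → ℚ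
powℤ x (+ n)      = pow x n
powℤ x (-[1+ n ]) = inv (pow x (suc n))

Σ1 : ℕ → (ℕ → ℚ) → ℚ
Σ1 zero    f = 0ℚ
Σ1 (suc n) f = Σ1 n f ℚ.+ f (suc n)

sumℚ : List ℚ → ℚ
sumℚ []       = 0ℚ
sumℚ (x ∷ xs) = x ℚ.+ sumℚ xs

qint : ℚ → ℕ → ℚ
qint q k = (1ℚ ℚ.- pow q k) ℚ.* inv (1ℚ ℚ.- q)

qpoch : ℚ → ℕ → ℚ
qpoch q zero    = 1ℚ
qpoch q (suc n) = qpoch q n ℚ.* (1ℚ ℚ.- pow q (suc n))

qbinom : ℚ → ℕ → ℕ → ℚ
qbinom q n k with k ℕ.≤? n
... | yes _ = qpoch q n ℚ.* inv (qpoch q k ℚ.* qpoch q (n ∸ k))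
... | no _  = 0ℚ

-- Signed numbers 𝔻₀ : pos k = k, bar k = k̄

data 𝔻 : Set where
  pos : ℕ → 𝔻
  bar : ℕ → 𝔻

∣_∣ᵈ : 𝔻 → ℕ
∣ pos k ∣ᵈ = k
∣ bar k ∣ᵈ = k

sgnPow : 𝔻 → ℕ → ℚ
sgnPow (pos _) k = 1ℚ
sgnPow (bar _) k = pow (ℚ.- 1ℚ) k

_⊕_ : 𝔻 → 𝔻 → 𝔻
pos a ⊕ pos b = pos (a ℕ.+ b)
pos a ⊕ bar b = bar (a ℕ.+ b)
bar a ⊕ pos b = bar (a ℕ.+ b)
bar a ⊕ bar b = pos (a ℕ.+ b)

data Zθ : Set where
  int : ℤ → Zθ
  θ   : Zθ

_⊞_ : Zθ → Zθ → Zθ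
θ ⊞ a = a
int a ⊞ θ = int a
int (+ 1) ⊞ int -[1+ 0 ] = θ
int -[1+ 0 ] ⊞ int (+ 1) = int (+ 0)
int a ⊞ int b = int (a ℤ.+ b)

tri : ℕ → ℕ
tri zero    = 0
tri (suc k) = tri k ℕ.+ k

Qe : Zθ → ℕ → ℤ
Qe (int (+ suc m))  k = + (suc m ℕ.* tri k)
Qe (int (+ zero))   k = ℤ.- (+ k)
Qe (int -[1+ m ])   k = (-[1+ m ] ℤ.* + tri k) ℤ.- + k
Qe θ                k = + 0

Hstar : ℚ → ℕ → List 𝔻 → ℚ
Hstar q n []       = 1ℚ
Hstar q n (s ∷ ss) =
  Σ1 n (λ k → sgnPow s k ℚ.* pow q k ℚ.* inv (pow (qint q k) ∣ s ∣ᵈ) ℚ.* Hstar q k ss)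

Triple : Set
Triple = 𝔻 × ℕ × Zθ

hterm : ℚ → Triple → ℕ → ℚ
hterm q (s , t , r) k =
  sgnPow s k ℚ.* powℤ q (+ (t ℕ.* k) ℤ.+ Qe r k)
    ℚ.* (1ℚ ℚ.+ pow q k) ℚ.* inv (pow (qint q k) ∣ s ∣ᵈ)

Hstrict : ℚ → ℕ → List Triple → ℚ
Hstrict q b []       = 1ℚ
Hstrict q b (x ∷ xs) = Σ1 b (λ k → hterm q x k ℚ.* Hstrict q (k ∸ 1) xs)

-- 𝓗_n (for m ≥ 1; the empty list is never used)
calH : ℚ → ℕ → List Triple → ℚ
calH q n []       = 0ℚ
calH q n (x ∷ xs) =
  Σ1 n (λ k → qbinom q n k ℚ.* inv (qbinom q (n ℕ.+ k) k)
               ℚ.* hterm q x k ℚ.* Hstrict q (k ∸ 1) xs)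

-- Merging: all 2^{N-1} comma/merge choices, runs combined left to right

combine : Triple → Triple → Triple
combine (s , t , r) (s' , t' , r') = (s ⊕ s' , t ℕ.+ t' , r ⊞ r')

mergesFrom : Triple → List Triple → List (List Triple)
mergesFrom acc []       = (acc ∷ []) ∷ []
mergesFrom acc (y ∷ ys) =
  map (acc ∷_) (mergesFrom y ys) ++ mergesFrom (combine acc y) ys

merges : List Triple → List (List Triple)
merges []       = []
merges (x ∷ xs) = mergesFrom x xs

-- The index s and the three strings of Π(s).
-- Parameters: a₁ and blocks = ((c₁ , a₂) , … , (c_ℓ , a_{ℓ+1})).

sIndex : ℕ → List (ℕ × ℕ) → List 𝔻
sIndex a₁ blocks =
  replicate a₁ (pos 2) ++ concat (map (λ { (c , a') → pos c ∷ replicate a' (pos 2) }) blocks)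

body1 : List (ℕ × ℕ) → List 𝔻
body1 []                    = []
body1 ((c , a') ∷ [])       = replicate (c ∸ 3) (pos 1) ++ (pos (2 ℕ.* a' ℕ.+ 1) ∷ [])
body1 ((c , a') ∷ b ∷ bs)   = replicate (c ∸ 3) (pos 1) ++ (pos (2 ℕ.* a' ℕ.+ 3) ∷ body1 (b ∷ bs))

str1 : ℕ → List (ℕ × ℕ) → List 𝔻
str1 a₁ blocks = bar (2 ℕ.* a₁ ℕ.+ 2) ∷ body1 blocks

body2 : List (ℕ × ℕ) → List ℕ
body2 []                    = []
body2 ((c , a') ∷ [])       = replicate (c ∸ 3) 0 ++ (a' ∷ [])
body2 ((c , a') ∷ b ∷ bs)   = replicate (c ∸ 3) 0 ++ ((a' ℕ.+ 1) ∷ body2 (b ∷ bs))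

str2 : ℕ → List (ℕ × ℕ) → List ℕ
str2 a₁ blocks = (a₁ ℕ.+ 1) ∷ body2 blocks

str3 : List (ℕ × ℕ) → List Zθ
str3 blocks = int (+ 1) ∷ concat (map (λ { (c , _) → replicate (c ∸ 2) θ }) blocks)

Π : ℕ → List (ℕ × ℕ) → List (List Triple)
Π a₁ blocks = merges (zip (str1 a₁ blocks) (zip (str2 a₁ blocks) (str3 blocks)))

{-# OPTIONS --safe #-}
-- Both sides are expanded in the basis n ↦ ρ n k = binom(n,k)/binom(n+k,k), k ≤ n: s expands with
-- coefficients X when H⋆_m[s] = Σ_{k≤m} ρ m k X k for all m ≥ 1. The closed form of ρ gives
-- (ρ (n+1) k − ρ n k) w k = w (n+1) ρ (n+1) k with w k = q^k/[k]², hence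
-- Σ_{m≤n} w m Σ_{k≤m} ρ m k X k = Σ_{k≤n} ρ n k w k X k: prepending an entry 2 + d to s turns
-- coefficients X into w Z, where Z expands [m]^(−d) Σ_{k≤m} ρ m k X k.
-- On the right, the weights α n k = ρ n k (−1)^k q^(k(k−1)/2) have telescoping tail sums
-- Σ_{j≤k≤n} α n k (1 + q^k) (equal to −1 for j = 1), so Abel summation shows that prepending an entry
-- of Π(s) divides the expansion by [n]. The c − 3 ones and the last entry of a block thus supply
-- [n]^(2−c), the last entry also supplies the weights w of the following twos, and the sum over all
-- merges factors entry by entry because merging a plain entry into a run only multiplies its term.
module Submission where

open import Defs
open import Data.Nat using (ℕ; _≤_)
open import Data.Rational using (ℚ; 0ℚ; 1ℚ; _<_; -_)
open import Data.List using (List; length; map)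
open import Data.List.Relation.Unary.All using (All)
open import Data.Product using (_×_; proj₁)
open import Relation.Binary.PropositionalEquality using (_≡_)

open import Level using (0ℓ)
open import Data.Nat as ℕ using (zero; suc; _∸_; z≤n; s≤s)
import Data.Nat.Properties as ℕₚ
import Data.Integer as ℤ
open import Data.Rational as ℚ using (_+_; _*_; _-_)
import Data.Rational.Properties as ℚₚ
open import Data.List using ([]; _∷_; _++_; replicate; zip; drop)
import Data.List.Properties as Listₚ
open import Data.List.Relation.Unary.All using ([]; _∷_)
open import Data.List.Relation.Unary.All.Properties using (++⁺; replicate⁺)
open import Data.Product using (_,_)
open import Data.Sum using (inj₁; inj₂)
open import Relation.Binary.PropositionalEquality
  using (_≢_; refl; sym; trans; cong; cong₂; module ≡-Reasoning)
open import Relation.Nullary using (Dec; yes; no)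
open import Relation.Nullary.Negation using (contradiction)
open import Relation.Nullary.Decidable.Core using (dec⇒maybe)
open import Algebra.Bundles using (CommutativeRing)
open import Algebra.Properties.CommutativeSemiring.Exp
  (CommutativeRing.commutativeSemiring ℚₚ.+-*-commutativeRing)
  using (_^_; ^-homo-*; ^-assocʳ; ^-distrib-*)
open import Tactic.RingSolver using (solve-∀)
open import Tactic.RingSolver.Core.AlmostCommutativeRing
  using (AlmostCommutativeRing; fromCommutativeRing)

open ≡-Reasoning

ℚ-ring : AlmostCommutativeRing 0ℓ 0ℓ
ℚ-ring = fromCommutativeRing ℚₚ.+-*-commutativeRing (λ x → dec⇒maybe (0ℚ ℚₚ.≟ x))

*-interchange : ∀ a b c d → a * b * (c * d) ≡ a * c * (b * d)
*-interchange = solve-∀ ℚ-ring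

1≢0 : 1ℚ ≢ 0ℚ
1≢0 ()

inv-inverseʳ : ∀ {x} → x ≢ 0ℚ → x * inv x ≡ 1ℚ
inv-inverseʳ {x} x≢0 with x ℚₚ.≟ 0ℚ
... | yes x≡0 = contradiction x≡0 x≢0
... | no  x≢0 = ℚₚ.*-inverseʳ x {{ℚ.≢-nonZero x≢0}}

inv-inverseˡ : ∀ {x} → x ≢ 0ℚ → inv x * x ≡ 1ℚ
inv-inverseˡ {x} x≢0 = trans (ℚₚ.*-comm (inv x) x) (inv-inverseʳ x≢0)

inv-unique : ∀ {x y} → x * y ≡ 1ℚ → inv x ≡ y
inv-unique {x} {y} xy≡1 = begin
  inv x            ≡⟨ sym (ℚₚ.*-identityʳ (inv x)) ⟩
  inv x * 1ℚ       ≡⟨ cong (inv x *_) (sym xy≡1) ⟩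
  inv x * (x * y)  ≡⟨ sym (ℚₚ.*-assoc (inv x) x y) ⟩
  inv x * x * y    ≡⟨ cong (_* y) (inv-inverseˡ x≢0) ⟩
  1ℚ * y           ≡⟨ ℚₚ.*-identityˡ y ⟩
  y                ∎
  where
  x≢0 : x ≢ 0ℚ
  x≢0 refl = 1≢0 (trans (sym xy≡1) (ℚₚ.*-zeroˡ y))

*-≢0 : ∀ {x y} → x ≢ 0ℚ → y ≢ 0ℚ → x * y ≢ 0ℚ
*-≢0 {x} {y} x≢0 y≢0 xy≡0 = y≢0 (begin
  y                ≡⟨ sym (ℚₚ.*-identityˡ y) ⟩
  1ℚ * y           ≡⟨ cong (_* y) (sym (inv-inverseˡ x≢0)) ⟩
  inv x * x * y    ≡⟨ ℚₚ.*-assoc (inv x) x y ⟩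
  inv x * (x * y)  ≡⟨ cong (inv x *_) xy≡0 ⟩
  inv x * 0ℚ       ≡⟨ ℚₚ.*-zeroʳ (inv x) ⟩
  0ℚ               ∎)

inv-≢0 : ∀ {x} → x ≢ 0ℚ → inv x ≢ 0ℚ
inv-≢0 {x} x≢0 inv≡0 =
  1≢0 (trans (sym (inv-inverseʳ x≢0)) (trans (cong (x *_) inv≡0) (ℚₚ.*-zeroʳ x)))

<1⇒1-≢0 : ∀ {x} → x < 1ℚ → 1ℚ - x ≢ 0ℚ
<1⇒1-≢0 {x} x<1 1-x≡0 = ℚₚ.<-irrefl x≡1 x<1
  where
  x≡1-[1-x] : ∀ x → x ≡ 1ℚ - (1ℚ - x)
  x≡1-[1-x] = solve-∀ ℚ-ring
  x≡1 : x ≡ 1ℚ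
  x≡1 = trans (x≡1-[1-x] x) (cong (λ y → 1ℚ - y) 1-x≡0)

*-cancelʳ-≢0 : ∀ {x y z} → z ≢ 0ℚ → x * z ≡ y * z → x ≡ y
*-cancelʳ-≢0 {x} {y} {z} z≢0 eq = begin
  x                   ≡⟨ sym (divide x) ⟩
  x * z * inv z       ≡⟨ cong (_* inv z) eq ⟩
  y * z * inv z       ≡⟨ divide y ⟩
  y                   ∎
  where
  divide : ∀ u → u * z * inv z ≡ u
  divide u = trans (ℚₚ.*-assoc u z (inv z))
               (trans (cong (u *_) (inv-inverseʳ z≢0)) (ℚₚ.*-identityʳ u))

inv-distrib-* : ∀ x y → inv (x * y) ≡ inv x * inv y
inv-distrib-* x y = by-cases (x ℚₚ.≟ 0ℚ) (y ℚₚ.≟ 0ℚ)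
  where
  by-cases : Dec (x ≡ 0ℚ) → Dec (y ≡ 0ℚ) → inv (x * y) ≡ inv x * inv y
  by-cases (yes refl) _          = trans (cong inv (ℚₚ.*-zeroˡ y)) (sym (ℚₚ.*-zeroˡ (inv y)))
  by-cases (no _)     (yes refl) = trans (cong inv (ℚₚ.*-zeroʳ x)) (sym (ℚₚ.*-zeroʳ (inv x)))
  by-cases (no x≢0)   (no y≢0)   = inv-unique {x * y} (begin
    x * y * (inv x * inv y)    ≡⟨ *-interchange x y (inv x) (inv y) ⟩
    x * inv x * (y * inv y)    ≡⟨ cong₂ _*_ (inv-inverseʳ x≢0) (inv-inverseʳ y≢0) ⟩
    1ℚ                         ∎)

inv-involutive : ∀ x → inv (inv x) ≡ x
inv-involutive x = by-cases (x ℚₚ.≟ 0ℚ)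
  where
  by-cases : Dec (x ≡ 0ℚ) → inv (inv x) ≡ x
  by-cases (yes refl) = refl
  by-cases (no x≢0)   = inv-unique {inv x} (inv-inverseˡ x≢0)

pow≗^ : ∀ x n → pow x n ≡ x ^ n
pow≗^ x zero    = refl
pow≗^ x (suc n) = cong (x *_) (pow≗^ x n)

pow-+ : ∀ x m n → pow x (m ℕ.+ n) ≡ pow x m * pow x n
pow-+ x m n = trans (pow≗^ x (m ℕ.+ n))
  (trans (^-homo-* x m n) (sym (cong₂ _*_ (pow≗^ x m) (pow≗^ x n))))

pow-* : ∀ x m n → pow x (m ℕ.* n) ≡ pow (pow x m) n
pow-* x m n = trans (pow≗^ x (m ℕ.* n))
  (trans (sym (^-assocʳ x m n)) (sym (trans (pow≗^ (pow x m) n) (cong (_^ n) (pow≗^ x m)))))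

pow-distrib-* : ∀ x y n → pow (x * y) n ≡ pow x n * pow y n
pow-distrib-* x y n = trans (pow≗^ (x * y) n)
  (trans (^-distrib-* x y n) (sym (cong₂ _*_ (pow≗^ x n) (pow≗^ y n))))

inv-pow : ∀ x n → inv (pow x n) ≡ pow (inv x) n
inv-pow x zero    = refl
inv-pow x (suc n) = trans (inv-distrib-* x (pow x n)) (cong (inv x *_) (inv-pow x n))

Σ1-cong : ∀ n {f g : ℕ → ℚ} → (∀ k → 1 ≤ k → k ≤ n → f k ≡ g k) → Σ1 n f ≡ Σ1 n g
Σ1-cong zero    f≗g = refl
Σ1-cong (suc n) f≗g = cong₂ _+_
  (Σ1-cong n (λ k 1≤k k≤n → f≗g k 1≤k (ℕₚ.m≤n⇒m≤1+n k≤n)))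
  (f≗g (suc n) (s≤s z≤n) ℕₚ.≤-refl)

Σ1-zero : ∀ n → Σ1 n (λ _ → 0ℚ) ≡ 0ℚ
Σ1-zero zero    = refl
Σ1-zero (suc n) = trans (ℚₚ.+-identityʳ _) (Σ1-zero n)

Σ1-distrib-+ : ∀ n (f g : ℕ → ℚ) → Σ1 n (λ k → f k + g k) ≡ Σ1 n f + Σ1 n g
Σ1-distrib-+ zero    f g = refl
Σ1-distrib-+ (suc n) f g =
  trans (cong (_+ (f (suc n) + g (suc n))) (Σ1-distrib-+ n f g))
        (interchange (Σ1 n f) (Σ1 n g) (f (suc n)) (g (suc n)))
  where
  interchange : ∀ a b c d → (a + b) + (c + d) ≡ (a + c) + (b + d)
  interchange = solve-∀ ℚ-ring

*-distribˡ-Σ1 : ∀ n a (f : ℕ → ℚ) → a * Σ1 n f ≡ Σ1 n (λ k → a * f k)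
*-distribˡ-Σ1 zero    a f = ℚₚ.*-zeroʳ a
*-distribˡ-Σ1 (suc n) a f =
  trans (ℚₚ.*-distribˡ-+ a (Σ1 n f) (f (suc n))) (cong (_+ a * f (suc n)) (*-distribˡ-Σ1 n a f))

neg-distrib-Σ1 : ∀ n (f : ℕ → ℚ) → - Σ1 n f ≡ Σ1 n (λ k → - f k)
neg-distrib-Σ1 zero    f = refl
neg-distrib-Σ1 (suc n) f =
  trans (ℚₚ.neg-distrib-+ (Σ1 n f) (f (suc n))) (cong (_+ - f (suc n)) (neg-distrib-Σ1 n f))

Σ1-distrib-- : ∀ n (f g : ℕ → ℚ) → Σ1 n (λ k → f k - g k) ≡ Σ1 n f - Σ1 n g
Σ1-distrib-- n f g =
  trans (Σ1-distrib-+ n f (λ k → - g k)) (cong (Σ1 n f +_) (sym (neg-distrib-Σ1 n g)))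

Σ1-telescope : ∀ m {f g : ℕ → ℚ} → (∀ k → 1 ≤ k → k ≤ m → f k ≡ g k - g (suc k)) →
               Σ1 m f ≡ g 1 - g (suc m)
Σ1-telescope zero    {g = g} _  = sym (ℚₚ.+-inverseʳ (g 1))
Σ1-telescope (suc m) {f} {g} eq = begin
  Σ1 m f + f (suc m)
    ≡⟨ cong₂ _+_ (Σ1-telescope m {g = g} (λ k 1≤k k≤m → eq k 1≤k (ℕₚ.m≤n⇒m≤1+n k≤m)))
                 (eq (suc m) (s≤s z≤n) ℕₚ.≤-refl) ⟩
  (g 1 - g (suc m)) + (g (suc m) - g (suc (suc m)))
    ≡⟨ cancel-middle (g 1) (g (suc m)) (g (suc (suc m))) ⟩
  g 1 - g (suc (suc m)) ∎
  where
  cancel-middle : ∀ a b c → (a - b) + (b - c) ≡ a - c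
  cancel-middle = solve-∀ ℚ-ring

Σ1-abel : ∀ n (a p h : ℕ → ℚ) →
  Σ1 n (λ k → a k * (Σ1 k h + p k * Σ1 (k ∸ 1) h))
    ≡ Σ1 n (λ k → a k * (1ℚ + p k)) * Σ1 n h
      - Σ1 n (λ j → h j * (Σ1 (j ∸ 1) (λ k → a k * (1ℚ + p k)) + p j * a j))
Σ1-abel zero    a p h = refl
Σ1-abel (suc n) a p h =
  trans (cong (_+ a (suc n) * ((Σ1 n h + h (suc n)) + p (suc n) * Σ1 n h)) (Σ1-abel n a p h))
        (abel-step (Σ1 n f) (Σ1 n h) (Σ1 n (λ j → h j * (Σ1 (j ∸ 1) f + p j * a j)))
                   (a (suc n)) (h (suc n)) (p (suc n)))
  where
  f : ℕ → ℚ
  f k = a k * (1ℚ + p k)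
  abel-step : ∀ A H U a′ h′ p′ →
    (A * H - U) + a′ * ((H + h′) + p′ * H) ≡ (A + a′ * (1ℚ + p′)) * (H + h′) - (U + h′ * (A + p′ * a′))
  abel-step = solve-∀ ℚ-ring

sumℚ-++ : ∀ xs ys → sumℚ (xs ++ ys) ≡ sumℚ xs + sumℚ ys
sumℚ-++ []       ys = sym (ℚₚ.+-identityˡ (sumℚ ys))
sumℚ-++ (x ∷ xs) ys = trans (cong (x +_) (sumℚ-++ xs ys)) (sym (ℚₚ.+-assoc x (sumℚ xs) (sumℚ ys)))

sumℚ-Σ1 : ∀ {A : Set} b (α : ℕ → ℚ) (g : ℕ → A → ℚ) (L : List A) →
          sumℚ (map (λ m → Σ1 b (λ k → α k * g k m)) L) ≡ Σ1 b (λ k → α k * sumℚ (map (g k) L))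
sumℚ-Σ1 b α g []      = sym (trans (Σ1-cong b (λ k _ _ → ℚₚ.*-zeroʳ (α k))) (Σ1-zero b))
sumℚ-Σ1 b α g (m ∷ L) = begin
  Σ1 b (λ k → α k * g k m) + sumℚ (map (λ m → Σ1 b (λ k → α k * g k m)) L)
    ≡⟨ cong (Σ1 b (λ k → α k * g k m) +_) (sumℚ-Σ1 b α g L) ⟩
  Σ1 b (λ k → α k * g k m) + Σ1 b (λ k → α k * sumℚ (map (g k) L))
    ≡⟨ sym (Σ1-distrib-+ b _ _) ⟩
  Σ1 b (λ k → α k * g k m + α k * sumℚ (map (g k) L))
    ≡⟨ Σ1-cong b (λ k _ _ → sym (ℚₚ.*-distribˡ-+ (α k) (g k m) _)) ⟩
  Σ1 b (λ k → α k * (g k m + sumℚ (map (g k) L))) ∎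

data Plain : Triple → Set where
  plain : ∀ s t → Plain (pos s , t , θ)

-- For these r we have Q(r,k) ≥ 0, so the exponent of a merged run splits without inverses.
data NonNegQ : Zθ → Set where
  nn-θ   : NonNegQ θ
  nn-suc : ∀ m → NonNegQ (int (ℤ.+ suc m))

⊞θ-nonNeg : ∀ {r} → NonNegQ r → NonNegQ (r ⊞ θ)
⊞θ-nonNeg nn-θ       = nn-θ
⊞θ-nonNeg (nn-suc m) = nn-suc m

⊞-θ : ∀ r → r ⊞ θ ≡ r
⊞-θ θ       = refl
⊞-θ (int _) = refl

-- Π(s) consists of the merges of first a₁ followed by tailTriples blocks (Π≡merges): a block
-- (c , a) of s contributes c − 3 entries one and then blockEnd a.
one : Triple
one = pos 1 , 0 , θ

first : ℕ → Triple
first a₁ = bar (2 ℕ.* a₁ ℕ.+ 2) , a₁ ℕ.+ 1 , int (ℤ.+ 1)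

blockEnd : ℕ → List (ℕ × ℕ) → Triple
blockEnd a []      = pos (2 ℕ.* a ℕ.+ 1) , a , θ
blockEnd a (_ ∷ _) = pos (2 ℕ.* a ℕ.+ 3) , a ℕ.+ 1 , θ

tailTriples : List (ℕ × ℕ) → List Triple
tailTriples []             = []
tailTriples ((c , a) ∷ bl) = replicate (c ∸ 3) one ++ blockEnd a bl ∷ tailTriples bl

tailTriples-plain : ∀ bl → All Plain (tailTriples bl)
tailTriples-plain []             = []
tailTriples-plain ((c , a) ∷ bl) = ++⁺ (replicate⁺ (c ∸ 3) (plain 1 0)) (end-plain bl ∷ tailTriples-plain bl)
  where
  end-plain : ∀ bl → Plain (blockEnd a bl)
  end-plain []      = plain _ _
  end-plain (_ ∷ _) = plain _ _

replicate-snoc : ∀ {A : Set} d (x : A) xs → replicate (suc d) x ++ xs ≡ replicate d x ++ (x ∷ xs)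
replicate-snoc zero    x xs = refl
replicate-snoc (suc d) x xs = cong (x ∷_) (replicate-snoc d x xs)

zip₃-replicate : ∀ d (x : 𝔻) (y : ℕ) (z : Zθ) xs ys zs →
  zip (replicate d x ++ xs) (zip (replicate d y ++ ys) (replicate d z ++ zs))
    ≡ replicate d (x , y , z) ++ zip xs (zip ys zs)
zip₃-replicate zero    x y z xs ys zs = refl
zip₃-replicate (suc d) x y z xs ys zs = cong ((x , y , z) ∷_) (zip₃-replicate d x y z xs ys zs)

zip-block : ∀ d a bl zs →
  zip (body1 ((3 ℕ.+ d , a) ∷ bl)) (zip (body2 ((3 ℕ.+ d , a) ∷ bl)) (replicate d θ ++ (θ ∷ zs)))
    ≡ replicate d one ++ blockEnd a bl ∷ zip (body1 bl) (zip (body2 bl) zs)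
zip-block d a []      zs = zip₃-replicate d (pos 1) 0 θ _ _ _
zip-block d a (_ ∷ _) zs = zip₃-replicate d (pos 1) 0 θ _ _ _

Π≡merges : ∀ a₁ bl → All (λ b → 3 ≤ proj₁ b) bl → Π a₁ bl ≡ mergesFrom (first a₁) (tailTriples bl)
Π≡merges a₁ bl h = cong (mergesFrom (first a₁)) (tails bl h)
  where
  tails : ∀ bl → All (λ b → 3 ≤ proj₁ b) bl →
          zip (body1 bl) (zip (body2 bl) (drop 1 (str3 bl))) ≡ tailTriples bl
  tails []             []                               = refl
  tails ((_ , a) ∷ bl) (s≤s (s≤s (s≤s {n = d} _)) ∷ h) = begin
    zip (body1 ((3 ℕ.+ d , a) ∷ bl)) (zip (body2 ((3 ℕ.+ d , a) ∷ bl)) (replicate (suc d) θ ++ drop 1 (str3 bl)))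
      ≡⟨ cong (λ zs → zip (body1 ((3 ℕ.+ d , a) ∷ bl)) (zip (body2 ((3 ℕ.+ d , a) ∷ bl)) zs))
              (replicate-snoc d θ (drop 1 (str3 bl))) ⟩
    zip (body1 ((3 ℕ.+ d , a) ∷ bl)) (zip (body2 ((3 ℕ.+ d , a) ∷ bl)) (replicate d θ ++ (θ ∷ drop 1 (str3 bl))))
      ≡⟨ zip-block d a bl (drop 1 (str3 bl)) ⟩
    replicate d one ++ blockEnd a bl ∷ zip (body1 bl) (zip (body2 bl) (drop 1 (str3 bl)))
      ≡⟨ cong (λ T → replicate d one ++ blockEnd a bl ∷ T) (tails bl h) ⟩
    replicate d one ++ blockEnd a bl ∷ tailTriples bl ∎

-- (1 − XY)² − Y (1 − X)² = (1 − Y)(1 − X²Y); below X = q^k and Y = q^(n+1−k).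
w-step-algebra : ∀ A B X Y V W r → 1ℚ - X ≢ 0ℚ → 1ℚ - X * Y ≢ 0ℚ →
  V * ((1ℚ - X) * (1ℚ - X)) ≡ X * r →
  W * ((1ℚ - X * Y) * (1ℚ - X * Y)) ≡ X * Y * r →
  A * ((1ℚ - Y) * (1ℚ - X * Y * X)) ≡ B * ((1ℚ - X * Y) * (1ℚ - X * Y)) →
  (A - B) * V ≡ W * A
w-step-algebra A B X Y V W r 1-X≢0 1-XY≢0 hV hW ratio =
  *-cancelʳ-≢0 (*-≢0 (*-≢0 1-X≢0 1-X≢0) (*-≢0 1-XY≢0 1-XY≢0)) (begin
    (A - B) * V * (u * v)
      ≡⟨ regroup₁ (A - B) V u v ⟩
    (A - B) * (V * u) * v
      ≡⟨ cong (λ t → (A - B) * t * v) hV ⟩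
    (A - B) * (X * r) * v
      ≡⟨ expand A B X Y r ⟩
    r * X * (A * ((1ℚ - Y) * (1ℚ - X * Y * X)) - B * v) + X * Y * r * A * u
      ≡⟨ cong (λ t → r * X * (t - B * v) + X * Y * r * A * u) ratio ⟩
    r * X * (B * v - B * v) + X * Y * r * A * u
      ≡⟨ cancel (r * X) (B * v) (X * Y * r * A * u) ⟩
    X * Y * r * A * u
      ≡⟨ cong (λ t → t * A * u) hW ⟨
    W * v * A * u
      ≡⟨ regroup₂ W v A u ⟩
    W * A * (u * v) ∎)
  where
  u v : ℚ
  u = (1ℚ - X) * (1ℚ - X)
  v = (1ℚ - X * Y) * (1ℚ - X * Y)
  regroup₁ : ∀ a V u v → a * V * (u * v) ≡ a * (V * u) * v
  regroup₁ = solve-∀ ℚ-ring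
  expand : ∀ A B X Y r → (A - B) * (X * r) * ((1ℚ - X * Y) * (1ℚ - X * Y))
    ≡ r * X * (A * ((1ℚ - Y) * (1ℚ - X * Y * X)) - B * ((1ℚ - X * Y) * (1ℚ - X * Y)))
      + X * Y * r * A * ((1ℚ - X) * (1ℚ - X))
  expand = solve-∀ ℚ-ring
  cancel : ∀ a C D → a * (C - C) + D ≡ D
  cancel = solve-∀ ℚ-ring
  regroup₂ : ∀ W v A u → W * v * A * u ≡ W * A * (u * v)
  regroup₂ = solve-∀ ℚ-ring

module Expansion (q : ℚ) (0<q : 0ℚ < q) (q<1 : q < 1ℚ) where

  1-q^_ : ℕ → ℚ
  1-q^ m = 1ℚ - pow q m

  [_] : ℕ → ℚ
  [ k ] = qint q k

  poch : ℕ → ℚ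
  poch = qpoch q

  q^suc<1 : ∀ k → pow q (suc k) < 1ℚ
  q^suc<1 zero    = q*1<1
    where
    q*1<1 : q * 1ℚ < 1ℚ
    q*1<1 = ℚₚ.≤-<-trans (ℚₚ.≤-reflexive (ℚₚ.*-identityʳ q)) q<1
  q^suc<1 (suc k) = ℚₚ.≤-<-trans
    (ℚₚ.*-monoˡ-≤-nonNeg q {{ℚₚ.pos⇒nonNeg q {{ℚ.positive 0<q}}}} (ℚₚ.<⇒≤ (q^suc<1 k)))
    (q^suc<1 zero)

  1-q^≢0 : ∀ {k} → 1 ≤ k → 1-q^ k ≢ 0ℚ
  1-q^≢0 {suc k} _ = <1⇒1-≢0 (q^suc<1 k)

  1-q≢0 : 1ℚ - q ≢ 0ℚ
  1-q≢0 = <1⇒1-≢0 q<1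

  poch≢0 : ∀ n → poch n ≢ 0ℚ
  poch≢0 zero    = 1≢0
  poch≢0 (suc n) = *-≢0 (poch≢0 n) (1-q^≢0 {suc n} (s≤s z≤n))

  qint≢0 : ∀ {k} → 1 ≤ k → [ k ] ≢ 0ℚ
  qint≢0 1≤k = *-≢0 (1-q^≢0 1≤k) (inv-≢0 1-q≢0)

  qint-*-1-q : ∀ k → [ k ] * (1ℚ - q) ≡ 1-q^ k
  qint-*-1-q k = trans (ℚₚ.*-assoc (1-q^ k) (inv (1ℚ - q)) (1ℚ - q))
    (trans (cong (1-q^ k *_) (inv-inverseˡ 1-q≢0)) (ℚₚ.*-identityʳ (1-q^ k)))

  qint-ratio : ∀ j {n} → [ j ] * inv [ n ] ≡ 1-q^ j * inv (1-q^ n)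
  qint-ratio j {n} = begin
    1-q^ j * inv (1ℚ - q) * inv (1-q^ n * inv (1ℚ - q))
      ≡⟨ cong (1-q^ j * inv (1ℚ - q) *_)
              (trans (inv-distrib-* (1-q^ n) _) (cong (inv (1-q^ n) *_) (inv-involutive _))) ⟩
    1-q^ j * inv (1ℚ - q) * (inv (1-q^ n) * (1ℚ - q))
      ≡⟨ regroup (1-q^ j) (inv (1ℚ - q)) (inv (1-q^ n)) (1ℚ - q) ⟩
    1-q^ j * inv (1-q^ n) * (inv (1ℚ - q) * (1ℚ - q))
      ≡⟨ cong (1-q^ j * inv (1-q^ n) *_) (inv-inverseˡ 1-q≢0) ⟩
    1-q^ j * inv (1-q^ n) * 1ℚ
      ≡⟨ ℚₚ.*-identityʳ _ ⟩
    1-q^ j * inv (1-q^ n) ∎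
    where
    regroup : ∀ a b c d → a * b * (c * d) ≡ a * c * (b * d)
    regroup = solve-∀ ℚ-ring

  qint-inv-pow-suc : ∀ {j} → 1 ≤ j → ∀ e → [ j ] * inv (pow [ j ] (suc e)) ≡ inv (pow [ j ] e)
  qint-inv-pow-suc {j} 1≤j e = begin
    [ j ] * inv ([ j ] * pow [ j ] e)
      ≡⟨ cong ([ j ] *_) (inv-distrib-* [ j ] (pow [ j ] e)) ⟩
    [ j ] * (inv [ j ] * inv (pow [ j ] e))
      ≡⟨ sym (ℚₚ.*-assoc [ j ] (inv [ j ]) (inv (pow [ j ] e))) ⟩
    [ j ] * inv [ j ] * inv (pow [ j ] e)
      ≡⟨ cong (_* inv (pow [ j ] e)) (inv-inverseʳ (qint≢0 1≤j)) ⟩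
    1ℚ * inv (pow [ j ] e)
      ≡⟨ ℚₚ.*-identityˡ (inv (pow [ j ] e)) ⟩
    inv (pow [ j ] e) ∎

  ρ : ℕ → ℕ → ℚ
  ρ n k = qbinom q n k * inv (qbinom q (n ℕ.+ k) k)

  𝒯 : ℕ → (ℕ → ℚ) → ℚ
  𝒯 n X = Σ1 n (λ k → ρ n k * X k)

  qbinom-≤ : ∀ {n k} → k ≤ n → qbinom q n k ≡ poch n * inv (poch k * poch (n ∸ k))
  qbinom-≤ {n} {k} k≤n with k ℕ.≤? n
  ... | yes _   = refl
  ... | no  k≰n = contradiction k≤n k≰n

  ρ-vanishes : ∀ {n k} → n ℕ.< k → ρ n k ≡ 0ℚ
  ρ-vanishes {n} {k} n<k with k ℕ.≤? n
  ... | yes k≤n = contradiction k≤n (ℕₚ.<⇒≱ n<k)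
  ... | no  _   = ℚₚ.*-zeroˡ (inv (qbinom q (n ℕ.+ k) k))

  ρ-cleared : ∀ {n k} → k ≤ n → ρ n k * (poch (n ∸ k) * poch (n ℕ.+ k)) ≡ poch n * poch n
  ρ-cleared {n} {k} k≤n = begin
    ρ n k * (poch (n ∸ k) * poch (n ℕ.+ k))
      ≡⟨ cong₂ (λ a b → a * inv b * (poch (n ∸ k) * poch (n ℕ.+ k)))
               (qbinom-≤ k≤n) (qbinom-≤ (ℕₚ.m≤n+m k n)) ⟩
    poch n * inv (poch k * poch (n ∸ k)) * inv (poch (n ℕ.+ k) * inv (poch k * poch (n ℕ.+ k ∸ k)))
      * (poch (n ∸ k) * poch (n ℕ.+ k))
      ≡⟨ cong (λ m → poch n * inv (poch k * poch (n ∸ k)) * inv (poch (n ℕ.+ k) * inv (poch k * poch m))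
                       * (poch (n ∸ k) * poch (n ℕ.+ k)))
              (ℕₚ.m+n∸n≡m n k) ⟩
    poch n * inv (poch k * poch (n ∸ k)) * inv (poch (n ℕ.+ k) * inv (poch k * poch n))
      * (poch (n ∸ k) * poch (n ℕ.+ k))
      ≡⟨ cong₂ (λ a b → poch n * a * b * (poch (n ∸ k) * poch (n ℕ.+ k)))
               (inv-distrib-* (poch k) _)
               (trans (inv-distrib-* (poch (n ℕ.+ k)) _) (cong (inv (poch (n ℕ.+ k)) *_) (inv-involutive _))) ⟩
    poch n * (inv (poch k) * inv (poch (n ∸ k))) * (inv (poch (n ℕ.+ k)) * (poch k * poch n))
      * (poch (n ∸ k) * poch (n ℕ.+ k))
      ≡⟨ regroup (poch n) (poch k) (poch (n ∸ k)) (poch (n ℕ.+ k))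
                 (inv (poch k)) (inv (poch (n ∸ k))) (inv (poch (n ℕ.+ k))) ⟩
    poch n * poch n * ((poch k * inv (poch k)) * (poch (n ∸ k) * inv (poch (n ∸ k)))
      * (poch (n ℕ.+ k) * inv (poch (n ℕ.+ k))))
      ≡⟨ cong (poch n * poch n *_)
              (cong₂ _*_ (cong₂ _*_ (inv-inverseʳ (poch≢0 k)) (inv-inverseʳ (poch≢0 (n ∸ k))))
                         (inv-inverseʳ (poch≢0 (n ℕ.+ k)))) ⟩
    poch n * poch n * (1ℚ * 1ℚ * 1ℚ)
      ≡⟨ ℚₚ.*-identityʳ _ ⟩
    poch n * poch n ∎
    where
    regroup : ∀ P K M N iK iM iN →
      P * (iK * iM) * (iN * (K * P)) * (M * N) ≡ P * P * ((K * iK) * (M * iM) * (N * iN))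
    regroup = solve-∀ ℚ-ring

  ρ-zero : ∀ n → ρ n 0 ≡ 1ℚ
  ρ-zero n = *-cancelʳ-≢0 (*-≢0 (poch≢0 n) (poch≢0 n)) (begin
    ρ n 0 * (poch n * poch n)              ≡⟨ cong (λ m → ρ n 0 * (poch n * poch m)) (sym (ℕₚ.+-identityʳ n)) ⟩
    ρ n 0 * (poch n * poch (n ℕ.+ 0))      ≡⟨ ρ-cleared {n} z≤n ⟩
    poch n * poch n                        ≡⟨ sym (ℚₚ.*-identityˡ (poch n * poch n)) ⟩
    1ℚ * (poch n * poch n)                 ∎)

  ρ-succʳ : ∀ {n j} → j ≤ n → ρ n (suc j) * 1-q^ (n ℕ.+ suc j) ≡ 1-q^ (n ∸ j) * ρ n j
  ρ-succʳ {n} {j} j≤n with ℕₚ.m≤n⇒m<n∨m≡n j≤n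
  ... | inj₂ refl = begin
    ρ n (suc n) * 1-q^ (n ℕ.+ suc n)  ≡⟨ cong (_* 1-q^ (n ℕ.+ suc n)) (ρ-vanishes (ℕₚ.n<1+n n)) ⟩
    0ℚ * 1-q^ (n ℕ.+ suc n)           ≡⟨ trans (ℚₚ.*-zeroˡ (1-q^ (n ℕ.+ suc n))) (sym (ℚₚ.*-zeroˡ (ρ n n))) ⟩
    0ℚ * ρ n n                        ≡⟨ cong (λ m → 1-q^ m * ρ n n) (sym (ℕₚ.n∸n≡0 n)) ⟩
    1-q^ (n ∸ n) * ρ n n              ∎
  ... | inj₁ j<n = *-cancelʳ-≢0 (*-≢0 (poch≢0 m) (poch≢0 (n ℕ.+ j))) (trans lhs (sym rhs))
    where
    m : ℕ
    m = n ∸ suc j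
    n∸j≡1+m : n ∸ j ≡ suc m
    n∸j≡1+m = ℕₚ.+-∸-assoc 1 j<n
    regroupˡ : ∀ a b c d → a * b * (c * d) ≡ a * (c * (d * b))
    regroupˡ = solve-∀ ℚ-ring
    regroupʳ : ∀ a b c d → a * b * (c * d) ≡ b * (c * a * d)
    regroupʳ = solve-∀ ℚ-ring
    lhs : ρ n (suc j) * 1-q^ (n ℕ.+ suc j) * (poch m * poch (n ℕ.+ j)) ≡ poch n * poch n
    lhs = begin
      ρ n (suc j) * 1-q^ (n ℕ.+ suc j) * (poch m * poch (n ℕ.+ j))
        ≡⟨ regroupˡ (ρ n (suc j)) (1-q^ (n ℕ.+ suc j)) (poch m) (poch (n ℕ.+ j)) ⟩
      ρ n (suc j) * (poch m * (poch (n ℕ.+ j) * 1-q^ (n ℕ.+ suc j)))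
        ≡⟨ cong (λ i → ρ n (suc j) * (poch m * (poch (n ℕ.+ j) * 1-q^ i))) (ℕₚ.+-suc n j) ⟩
      ρ n (suc j) * (poch (n ∸ suc j) * poch (suc (n ℕ.+ j)))
        ≡⟨ cong (λ i → ρ n (suc j) * (poch (n ∸ suc j) * poch i)) (sym (ℕₚ.+-suc n j)) ⟩
      ρ n (suc j) * (poch (n ∸ suc j) * poch (n ℕ.+ suc j))
        ≡⟨ ρ-cleared j<n ⟩
      poch n * poch n ∎
    rhs : 1-q^ (n ∸ j) * ρ n j * (poch m * poch (n ℕ.+ j)) ≡ poch n * poch n
    rhs = begin
      1-q^ (n ∸ j) * ρ n j * (poch m * poch (n ℕ.+ j))
        ≡⟨ cong (λ i → 1-q^ i * ρ n j * (poch m * poch (n ℕ.+ j))) n∸j≡1+m ⟩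
      1-q^ (suc m) * ρ n j * (poch m * poch (n ℕ.+ j))
        ≡⟨ regroupʳ (1-q^ (suc m)) (ρ n j) (poch m) (poch (n ℕ.+ j)) ⟩
      ρ n j * (poch (suc m) * poch (n ℕ.+ j))
        ≡⟨ cong (λ i → ρ n j * (poch i * poch (n ℕ.+ j))) (sym n∸j≡1+m) ⟩
      ρ n j * (poch (n ∸ j) * poch (n ℕ.+ j))
        ≡⟨ ρ-cleared (ℕₚ.<⇒≤ j<n) ⟩
      poch n * poch n ∎

  ρ-succˡ : ∀ {n k} → k ≤ n →
    ρ (suc n) k * (1-q^ (suc n ∸ k) * 1-q^ (suc n ℕ.+ k)) ≡ ρ n k * (1-q^ (suc n) * 1-q^ (suc n))
  ρ-succˡ {n} {k} k≤n = *-cancelʳ-≢0 (*-≢0 (poch≢0 (n ∸ k)) (poch≢0 (n ℕ.+ k))) (trans lhs (sym rhs))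
    where
    1+n∸k≡ : suc n ∸ k ≡ suc (n ∸ k)
    1+n∸k≡ = ℕₚ.+-∸-assoc 1 k≤n
    regroupˡ : ∀ r a b c d → r * (a * b) * (c * d) ≡ r * (c * a * (d * b))
    regroupˡ = solve-∀ ℚ-ring
    regroupʳ : ∀ r u P → r * (u * u) * P ≡ r * P * (u * u)
    regroupʳ = solve-∀ ℚ-ring
    square-* : ∀ a u → a * a * (u * u) ≡ a * u * (a * u)
    square-* = solve-∀ ℚ-ring
    lhs : ρ (suc n) k * (1-q^ (suc n ∸ k) * 1-q^ (suc n ℕ.+ k)) * (poch (n ∸ k) * poch (n ℕ.+ k))
          ≡ poch (suc n) * poch (suc n)
    lhs = begin
      ρ (suc n) k * (1-q^ (suc n ∸ k) * 1-q^ (suc n ℕ.+ k)) * (poch (n ∸ k) * poch (n ℕ.+ k))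
        ≡⟨ regroupˡ (ρ (suc n) k) (1-q^ (suc n ∸ k)) (1-q^ (suc n ℕ.+ k)) (poch (n ∸ k)) (poch (n ℕ.+ k)) ⟩
      ρ (suc n) k * (poch (n ∸ k) * 1-q^ (suc n ∸ k) * poch (suc n ℕ.+ k))
        ≡⟨ cong (λ i → ρ (suc n) k * (poch (n ∸ k) * 1-q^ i * poch (suc n ℕ.+ k))) 1+n∸k≡ ⟩
      ρ (suc n) k * (poch (suc (n ∸ k)) * poch (suc n ℕ.+ k))
        ≡⟨ cong (λ i → ρ (suc n) k * (poch i * poch (suc n ℕ.+ k))) (sym 1+n∸k≡) ⟩
      ρ (suc n) k * (poch (suc n ∸ k) * poch (suc n ℕ.+ k))
        ≡⟨ ρ-cleared (ℕₚ.m≤n⇒m≤1+n k≤n) ⟩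
      poch (suc n) * poch (suc n) ∎
    rhs : ρ n k * (1-q^ (suc n) * 1-q^ (suc n)) * (poch (n ∸ k) * poch (n ℕ.+ k))
          ≡ poch (suc n) * poch (suc n)
    rhs = begin
      ρ n k * (1-q^ (suc n) * 1-q^ (suc n)) * (poch (n ∸ k) * poch (n ℕ.+ k))
        ≡⟨ regroupʳ (ρ n k) (1-q^ (suc n)) (poch (n ∸ k) * poch (n ℕ.+ k)) ⟩
      ρ n k * (poch (n ∸ k) * poch (n ℕ.+ k)) * (1-q^ (suc n) * 1-q^ (suc n))
        ≡⟨ cong (_* (1-q^ (suc n) * 1-q^ (suc n))) (ρ-cleared k≤n) ⟩
      poch n * poch n * (1-q^ (suc n) * 1-q^ (suc n))
        ≡⟨ square-* (poch n) (1-q^ (suc n)) ⟩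
      poch (suc n) * poch (suc n) ∎

  w : ℕ → ℚ
  w k = pow q k * inv (pow [ k ] 2)

  w-cleared : ∀ {k} → 1 ≤ k → w k * (1-q^ k * 1-q^ k) ≡ pow q k * ((1ℚ - q) * (1ℚ - q))
  w-cleared {k} 1≤k = begin
    w k * (1-q^ k * 1-q^ k)
      ≡⟨ cong (λ x → w k * (x * x)) (sym (qint-*-1-q k)) ⟩
    pow q k * inv (pow [ k ] 2) * ([ k ] * (1ℚ - q) * ([ k ] * (1ℚ - q)))
      ≡⟨ regroup (pow q k) (inv (pow [ k ] 2)) [ k ] (1ℚ - q) ⟩
    pow q k * (inv (pow [ k ] 2) * pow [ k ] 2) * ((1ℚ - q) * (1ℚ - q))
      ≡⟨ cong (λ x → pow q k * x * ((1ℚ - q) * (1ℚ - q))) (inv-inverseˡ [k]²≢0) ⟩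
    pow q k * 1ℚ * ((1ℚ - q) * (1ℚ - q))
      ≡⟨ cong (_* ((1ℚ - q) * (1ℚ - q))) (ℚₚ.*-identityʳ (pow q k)) ⟩
    pow q k * ((1ℚ - q) * (1ℚ - q)) ∎
    where
    regroup : ∀ p i k r → p * i * (k * r * (k * r)) ≡ p * (i * (k * (k * 1ℚ))) * (r * r)
    regroup = solve-∀ ℚ-ring
    [k]²≢0 : pow [ k ] 2 ≢ 0ℚ
    [k]²≢0 = *-≢0 (qint≢0 1≤k) (*-≢0 (qint≢0 1≤k) 1≢0)

  ρ-w-step : ∀ {n k} → 1 ≤ k → k ≤ suc n → (ρ (suc n) k - ρ n k) * w k ≡ w (suc n) * ρ (suc n) k
  ρ-w-step {n} {k} 1≤k k≤1+n with ℕₚ.m≤n⇒m<n∨m≡n k≤1+n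
  ... | inj₂ refl = begin
    (ρ (suc n) (suc n) - ρ n (suc n)) * w (suc n)
      ≡⟨ cong (λ x → (ρ (suc n) (suc n) - x) * w (suc n)) (ρ-vanishes (ℕₚ.n<1+n n)) ⟩
    (ρ (suc n) (suc n) - 0ℚ) * w (suc n)
      ≡⟨ drop-zero (ρ (suc n) (suc n)) (w (suc n)) ⟩
    w (suc n) * ρ (suc n) (suc n) ∎
    where
    drop-zero : ∀ a b → (a - 0ℚ) * b ≡ b * a
    drop-zero = solve-∀ ℚ-ring
  ... | inj₁ (s≤s k≤n) =
    w-step-algebra (ρ (suc n) k) (ρ n k) X Y (w k) (w (suc n)) ((1ℚ - q) * (1ℚ - q))
      (1-q^≢0 1≤k) 1-XY≢0 (w-cleared 1≤k) w-cleared-XY ratio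
    where
    X Y : ℚ
    X = pow q k
    Y = pow q (suc n ∸ k)
    q^1+n≡XY : pow q (suc n) ≡ X * Y
    q^1+n≡XY = trans (cong (pow q) (sym (ℕₚ.m+[n∸m]≡n k≤1+n))) (pow-+ q k (suc n ∸ k))
    1-XY≢0 : 1ℚ - X * Y ≢ 0ℚ
    1-XY≢0 = λ e → 1-q^≢0 {suc n} (s≤s z≤n) (trans (cong (λ t → 1ℚ - t) q^1+n≡XY) e)
    w-cleared-XY : w (suc n) * ((1ℚ - X * Y) * (1ℚ - X * Y)) ≡ X * Y * ((1ℚ - q) * (1ℚ - q))
    w-cleared-XY = trans (cong (λ t → w (suc n) * ((1ℚ - t) * (1ℚ - t))) (sym q^1+n≡XY))
                         (trans (w-cleared {suc n} (s≤s z≤n)) (cong (_* ((1ℚ - q) * (1ℚ - q))) q^1+n≡XY))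
    ratio : ρ (suc n) k * ((1ℚ - Y) * (1ℚ - X * Y * X)) ≡ ρ n k * ((1ℚ - X * Y) * (1ℚ - X * Y))
    ratio = trans (cong (λ t → ρ (suc n) k * ((1ℚ - Y) * (1ℚ - t)))
                        (sym (trans (pow-+ q (suc n) k) (cong (_* X) q^1+n≡XY))))
                  (trans (ρ-succˡ k≤n) (cong (λ t → ρ n k * ((1ℚ - t) * (1ℚ - t))) q^1+n≡XY))

  Σ1-w𝒯 : ∀ n X → Σ1 n (λ m → w m * 𝒯 m X) ≡ 𝒯 n (λ j → w j * X j)
  Σ1-w𝒯 zero    X = refl
  Σ1-w𝒯 (suc n) X = begin
    Σ1 n (λ m → w m * 𝒯 m X) + w (suc n) * 𝒯 (suc n) X
      ≡⟨ cong₂ _+_ (trans (Σ1-w𝒯 n X) extend) (*-distribˡ-Σ1 (suc n) (w (suc n)) (λ j → ρ (suc n) j * X j)) ⟩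
    Σ1 (suc n) (λ j → ρ n j * (w j * X j)) + Σ1 (suc n) (λ j → w (suc n) * (ρ (suc n) j * X j))
      ≡⟨ sym (Σ1-distrib-+ (suc n) (λ j → ρ n j * (w j * X j)) (λ j → w (suc n) * (ρ (suc n) j * X j))) ⟩
    Σ1 (suc n) (λ j → ρ n j * (w j * X j) + w (suc n) * (ρ (suc n) j * X j))
      ≡⟨ Σ1-cong (suc n) step ⟩
    𝒯 (suc n) (λ j → w j * X j) ∎
    where
    extend : 𝒯 n (λ j → w j * X j) ≡ Σ1 (suc n) (λ j → ρ n j * (w j * X j))
    extend = sym (trans (cong (λ t → 𝒯 n (λ j → w j * X j) + t * (w (suc n) * X (suc n)))
                              (ρ-vanishes (ℕₚ.n<1+n n)))
                        (trans (cong (𝒯 n (λ j → w j * X j) +_) (ℚₚ.*-zeroˡ (w (suc n) * X (suc n))))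
                               (ℚₚ.+-identityʳ (𝒯 n (λ j → w j * X j)))))
    step : ∀ j → 1 ≤ j → j ≤ suc n →
           ρ n j * (w j * X j) + w (suc n) * (ρ (suc n) j * X j) ≡ ρ (suc n) j * (w j * X j)
    step j 1≤j j≤1+n = begin
      ρ n j * (w j * X j) + w (suc n) * (ρ (suc n) j * X j)
        ≡⟨ cong (ρ n j * (w j * X j) +_) (ℚₚ.*-assoc (w (suc n)) (ρ (suc n) j) (X j)) ⟨
      ρ n j * (w j * X j) + w (suc n) * ρ (suc n) j * X j
        ≡⟨ cong (λ t → ρ n j * (w j * X j) + t * X j) (ρ-w-step 1≤j j≤1+n) ⟨
      ρ n j * (w j * X j) + (ρ (suc n) j - ρ n j) * w j * X j
        ≡⟨ telescope (ρ n j) (ρ (suc n) j) (w j) (X j) ⟩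
      ρ (suc n) j * (w j * X j) ∎
      where
      telescope : ∀ b a v x → b * (v * x) + (a - b) * v * x ≡ a * (v * x)
      telescope = solve-∀ ℚ-ring

  record Expands (s : List 𝔻) (X : ℕ → ℚ) : Set where
    constructor expansion
    field
      Hstar≡𝒯 : ∀ m → 1 ≤ m → Hstar q m s ≡ 𝒯 m X

  open Expands

  expands-cong : ∀ {s X Y} → Expands s X → (∀ j → X j ≡ Y j) → Expands s Y
  expands-cong hs X≗Y = expansion λ m 1≤m →
    trans (Hstar≡𝒯 hs m 1≤m) (Σ1-cong m (λ j _ _ → cong (ρ m j *_) (X≗Y j)))

  expands-cons : ∀ d {s X Z} → Expands s X → (∀ m → 1 ≤ m → inv (pow [ m ] d) * 𝒯 m X ≡ 𝒯 m Z) →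
                 Expands (pos (2 ℕ.+ d) ∷ s) (λ j → w j * Z j)
  expands-cons d {s} {X} {Z} hs hZ = expansion λ m 1≤m → trans (Σ1-cong m (λ k 1≤k _ → term k 1≤k)) (Σ1-w𝒯 m Z)
    where
    regroup : ∀ p i₂ i-d t → 1ℚ * p * (i₂ * i-d) * t ≡ p * i₂ * (i-d * t)
    regroup = solve-∀ ℚ-ring
    term : ∀ k → 1 ≤ k → 1ℚ * pow q k * inv (pow [ k ] (2 ℕ.+ d)) * Hstar q k s ≡ w k * 𝒯 k Z
    term k 1≤k = begin
      1ℚ * pow q k * inv (pow [ k ] (2 ℕ.+ d)) * Hstar q k s
        ≡⟨ cong₂ (λ a b → 1ℚ * pow q k * inv a * b) (pow-+ [ k ] 2 d) (Hstar≡𝒯 hs k 1≤k) ⟩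
      1ℚ * pow q k * inv (pow [ k ] 2 * pow [ k ] d) * 𝒯 k X
        ≡⟨ cong (λ a → 1ℚ * pow q k * a * 𝒯 k X) (inv-distrib-* (pow [ k ] 2) (pow [ k ] d)) ⟩
      1ℚ * pow q k * (inv (pow [ k ] 2) * inv (pow [ k ] d)) * 𝒯 k X
        ≡⟨ regroup (pow q k) (inv (pow [ k ] 2)) (inv (pow [ k ] d)) (𝒯 k X) ⟩
      w k * (inv (pow [ k ] d) * 𝒯 k X)
        ≡⟨ cong (w k *_) (hZ k 1≤k) ⟩
      w k * 𝒯 k Z ∎

  expands-twos : ∀ a {s X} → Expands s X → Expands (replicate a (pos 2) ++ s) (λ j → pow (w j) a * X j)
  expands-twos zero    {X = X} hs = expands-cong hs (λ j → sym (ℚₚ.*-identityˡ (X j)))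
  expands-twos (suc a) {X = X} hs =
    expands-cong (expands-cons 0 (expands-twos a hs) (λ m _ → ℚₚ.*-identityˡ _))
                 (λ j → sym (ℚₚ.*-assoc (w j) (pow (w j) a) (X j)))

  σ : ℕ → ℚ
  σ j = pow (- 1ℚ) j * pow q (tri j)

  α : ℕ → ℕ → ℚ
  α n j = ρ n j * σ j

  β : ℕ → ℕ → ℚ
  β n j = α n j * (1ℚ + pow q j)

  -- Closed form of the tail sums Σ_{j≤k≤n} β n k (Σβ-tail).
  D : ℕ → ℕ → ℚ
  D n j = α n j * 1-q^ (n ℕ.+ j) * inv (1-q^ n)

  1-q^-split : ∀ {n j} → j ≤ n → 1-q^ (n ℕ.+ j) + pow q j * 1-q^ (n ∸ j) ≡ 1-q^ n * (1ℚ + pow q j)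
  1-q^-split {n} {j} j≤n = begin
    1ℚ - pow q (n ℕ.+ j) + Y * (1ℚ - Z)
      ≡⟨ cong (λ t → 1ℚ - t + Y * (1ℚ - Z)) (trans (pow-+ q n j) (cong (_* Y) q^n≡YZ)) ⟩
    1ℚ - Y * Z * Y + Y * (1ℚ - Z)
      ≡⟨ factor Y Z ⟩
    (1ℚ - Y * Z) * (1ℚ + Y)
      ≡⟨ cong (λ t → (1ℚ - t) * (1ℚ + Y)) (sym q^n≡YZ) ⟩
    1-q^ n * (1ℚ + Y) ∎
    where
    Y Z : ℚ
    Y = pow q j
    Z = pow q (n ∸ j)
    q^n≡YZ : pow q n ≡ Y * Z
    q^n≡YZ = trans (cong (pow q) (sym (ℕₚ.m+[n∸m]≡n j≤n))) (pow-+ q j (n ∸ j))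
    factor : ∀ Y Z → (1ℚ - Y * Z * Y) + Y * (1ℚ - Z) ≡ (1ℚ - Y * Z) * (1ℚ + Y)
    factor = solve-∀ ℚ-ring

  D-step : ∀ {n j} → 1 ≤ n → j ≤ n → D n j - D n (suc j) ≡ β n j
  D-step {n} {j} 1≤n j≤n = begin
    ρ n j * (s * T) * 1-q^ (n ℕ.+ j) * ι - ρ n (suc j) * (- 1ℚ * s * pow q (tri j ℕ.+ j)) * 1-q^ (n ℕ.+ suc j) * ι
      ≡⟨ cong (λ t → ρ n j * (s * T) * 1-q^ (n ℕ.+ j) * ι - ρ n (suc j) * (- 1ℚ * s * t) * 1-q^ (n ℕ.+ suc j) * ι)
              (pow-+ q (tri j) j) ⟩
    ρ n j * (s * T) * 1-q^ (n ℕ.+ j) * ι - ρ n (suc j) * (- 1ℚ * s * (T * Y)) * 1-q^ (n ℕ.+ suc j) * ι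
      ≡⟨ regroup₁ (ρ n j) (ρ n (suc j)) s T Y (1-q^ (n ℕ.+ j)) (1-q^ (n ℕ.+ suc j)) ι ⟩
    ρ n j * (s * T) * ι * 1-q^ (n ℕ.+ j) + s * T * Y * ι * (ρ n (suc j) * 1-q^ (n ℕ.+ suc j))
      ≡⟨ cong (λ t → ρ n j * (s * T) * ι * 1-q^ (n ℕ.+ j) + s * T * Y * ι * t) (ρ-succʳ j≤n) ⟩
    ρ n j * (s * T) * ι * 1-q^ (n ℕ.+ j) + s * T * Y * ι * (1-q^ (n ∸ j) * ρ n j)
      ≡⟨ regroup₂ (ρ n j) s T Y ι (1-q^ (n ℕ.+ j)) (1-q^ (n ∸ j)) ⟩
    α n j * (ι * (1-q^ (n ℕ.+ j) + Y * 1-q^ (n ∸ j)))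
      ≡⟨ cong (λ t → α n j * (ι * t)) (1-q^-split j≤n) ⟩
    α n j * (ι * (1-q^ n * (1ℚ + Y)))
      ≡⟨ cong (α n j *_) (trans (sym (ℚₚ.*-assoc ι (1-q^ n) (1ℚ + Y)))
                                (trans (cong (_* (1ℚ + Y)) (inv-inverseˡ (1-q^≢0 1≤n))) (ℚₚ.*-identityˡ (1ℚ + Y)))) ⟩
    β n j ∎
    where
    s T Y ι : ℚ
    s = pow (- 1ℚ) j
    T = pow q (tri j)
    Y = pow q j
    ι = inv (1-q^ n)
    regroup₁ : ∀ ρ₀ ρ₁ s T Y u v ι →
      ρ₀ * (s * T) * u * ι - ρ₁ * (- 1ℚ * s * (T * Y)) * v * ι ≡ ρ₀ * (s * T) * ι * u + s * T * Y * ι * (ρ₁ * v)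
    regroup₁ = solve-∀ ℚ-ring
    regroup₂ : ∀ ρ₀ s T Y ι u v →
      ρ₀ * (s * T) * ι * u + s * T * Y * ι * (v * ρ₀) ≡ ρ₀ * (s * T) * (ι * (u + Y * v))
    regroup₂ = solve-∀ ℚ-ring

  D-one : ∀ {n} → 1 ≤ n → D n 1 ≡ - 1ℚ
  D-one {n} 1≤n = begin
    ρ n 1 * σ 1 * 1-q^ (n ℕ.+ 1) * inv (1-q^ n)
      ≡⟨ regroup (ρ n 1) (1-q^ (n ℕ.+ 1)) (inv (1-q^ n)) ⟩
    - (ρ n 1 * 1-q^ (n ℕ.+ 1) * inv (1-q^ n))
      ≡⟨ cong (λ t → - (t * inv (1-q^ n))) (trans (ρ-succʳ {n} z≤n) (cong (1-q^ n *_) (ρ-zero n))) ⟩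
    - (1-q^ n * 1ℚ * inv (1-q^ n))
      ≡⟨ cong (λ t → - (t * inv (1-q^ n))) (ℚₚ.*-identityʳ (1-q^ n)) ⟩
    - (1-q^ n * inv (1-q^ n))
      ≡⟨ cong -_ (inv-inverseʳ (1-q^≢0 1≤n)) ⟩
    - 1ℚ ∎
    where
    regroup : ∀ r u ι → r * (- 1ℚ * 1ℚ * 1ℚ) * u * ι ≡ - (r * u * ι)
    regroup = solve-∀ ℚ-ring

  D-beyond : ∀ n → D n (suc n) ≡ 0ℚ
  D-beyond n = begin
    ρ n (suc n) * σ (suc n) * 1-q^ (n ℕ.+ suc n) * inv (1-q^ n)
      ≡⟨ cong (λ t → t * σ (suc n) * 1-q^ (n ℕ.+ suc n) * inv (1-q^ n)) (ρ-vanishes (ℕₚ.n<1+n n)) ⟩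
    0ℚ * σ (suc n) * 1-q^ (n ℕ.+ suc n) * inv (1-q^ n)
      ≡⟨ annihilate (σ (suc n)) (1-q^ (n ℕ.+ suc n)) (inv (1-q^ n)) ⟩
    0ℚ ∎
    where
    annihilate : ∀ a b c → 0ℚ * a * b * c ≡ 0ℚ
    annihilate = solve-∀ ℚ-ring

  Σβ-partial : ∀ {n} → 1 ≤ n → ∀ m → m ≤ n → Σ1 m (β n) ≡ D n 1 - D n (suc m)
  Σβ-partial {n} 1≤n m m≤n =
    Σ1-telescope m {g = D n} (λ k _ k≤m → sym (D-step 1≤n (ℕₚ.≤-trans k≤m m≤n)))

  Σβ-total : ∀ {n} → 1 ≤ n → Σ1 n (β n) ≡ - 1ℚ
  Σβ-total {n} 1≤n = begin
    Σ1 n (β n)              ≡⟨ Σβ-partial 1≤n n ℕₚ.≤-refl ⟩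
    D n 1 - D n (suc n)     ≡⟨ cong₂ _-_ (D-one 1≤n) (D-beyond n) ⟩
    - 1ℚ - 0ℚ               ≡⟨⟩
    - 1ℚ                    ∎

  Σβ-tail : ∀ {n j} → 1 ≤ n → 1 ≤ j → j ≤ n → Σ1 n (β n) - Σ1 (j ∸ 1) (β n) ≡ D n j
  Σβ-tail {n} {suc j} 1≤n _ j<n = begin
    Σ1 n (β n) - Σ1 j (β n)
      ≡⟨ cong₂ _-_ (Σβ-partial 1≤n n ℕₚ.≤-refl) (Σβ-partial 1≤n j (ℕₚ.<⇒≤ j<n)) ⟩
    (D n 1 - D n (suc n)) - (D n 1 - D n (suc j))
      ≡⟨ cong (λ t → (D n 1 - t) - (D n 1 - D n (suc j))) (D-beyond n) ⟩
    (D n 1 - 0ℚ) - (D n 1 - D n (suc j))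
      ≡⟨ cancel (D n 1) (D n (suc j)) ⟩
    D n (suc j) ∎
    where
    cancel : ∀ a b → (a - 0ℚ) - (a - b) ≡ b
    cancel = solve-∀ ℚ-ring

  D-α : ∀ {n} → 1 ≤ n → ∀ j → D n j - pow q j * α n j ≡ α n j * ([ j ] * inv [ n ])
  D-α {n} 1≤n j = begin
    α n j * (1ℚ - pow q (n ℕ.+ j)) * ι - pow q j * α n j
      ≡⟨ cong (λ t → α n j * (1ℚ - t) * ι - pow q j * α n j) (pow-+ q n j) ⟩
    α n j * (1ℚ - pow q n * pow q j) * ι - pow q j * α n j
      ≡⟨ expand (α n j) (pow q n) (pow q j) ι ⟩
    α n j * (1-q^ j * ι) + pow q j * α n j * (1-q^ n * ι - 1ℚ)
      ≡⟨ cong (λ t → α n j * (1-q^ j * ι) + pow q j * α n j * (t - 1ℚ)) (inv-inverseʳ (1-q^≢0 1≤n)) ⟩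
    α n j * (1-q^ j * ι) + pow q j * α n j * (1ℚ - 1ℚ)
      ≡⟨ drop-zero-term (α n j * (1-q^ j * ι)) (pow q j * α n j) ⟩
    α n j * (1-q^ j * ι)
      ≡⟨ cong (α n j *_) (sym (qint-ratio j {n})) ⟩
    α n j * ([ j ] * inv [ n ]) ∎
    where
    ι : ℚ
    ι = inv (1-q^ n)
    expand : ∀ a p y ι → a * (1ℚ - p * y) * ι - y * a ≡ a * ((1ℚ - y) * ι) + y * a * ((1ℚ - p) * ι - 1ℚ)
    expand = solve-∀ ℚ-ring
    drop-zero-term : ∀ u v → u + v * (1ℚ - 1ℚ) ≡ u
    drop-zero-term = solve-∀ ℚ-ring

  -- The factor by which merging a plain entry into a run multiplies the run's term (hterm-combine).
  gterm : Triple → ℕ → ℚ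
  gterm (s , t , r) k = sgnPow s k * powℤ q (ℤ.+ (t ℕ.* k) ℤ.+ Qe r k) * inv (pow [ k ] ∣ s ∣ᵈ)

  hterm≡gterm* : ∀ x k → hterm q x k ≡ gterm x k * (1ℚ + pow q k)
  hterm≡gterm* (s , t , r) k =
    swap-last (sgnPow s k) (powℤ q (ℤ.+ (t ℕ.* k) ℤ.+ Qe r k)) (1ℚ + pow q k) (inv (pow [ k ] ∣ s ∣ᵈ))
    where
    swap-last : ∀ a b c d → a * b * c * d ≡ a * b * d * c
    swap-last = solve-∀ ℚ-ring

  -- Φ T k sums over the merge patterns of T in which an initial run of T is merged into an entry
  -- at index k and the remaining entries sit strictly below k.
  Φ : List Triple → ℕ → ℚ
  Φ []       k = 1ℚ
  Φ (y ∷ ys) k = Σ1 (k ∸ 1) (λ j → hterm q y j * Φ ys j) + gterm y k * Φ ys k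

  E : List Triple → ℕ → ℚ
  E T k = - (σ k * ((1ℚ + pow q k) * Φ T k))

  expands-nil : Expands [] (E [])
  expands-nil = expansion λ m 1≤m → sym (begin
    Σ1 m (λ k → ρ m k * E [] k)      ≡⟨ Σ1-cong m (λ k _ _ → push-neg (ρ m k) (σ k) (1ℚ + pow q k)) ⟩
    Σ1 m (λ k → - β m k)             ≡⟨ neg-distrib-Σ1 m (β m) ⟨
    - Σ1 m (β m)                     ≡⟨ cong -_ (Σβ-total 1≤m) ⟩
    - - 1ℚ                           ≡⟨⟩
    1ℚ                               ∎)
    where
    push-neg : ∀ r s p → r * - (s * (p * 1ℚ)) ≡ - (r * s * p)
    push-neg = solve-∀ ℚ-ring

  α-abel : ∀ {n} → 1 ≤ n → ∀ h →
    Σ1 n (λ k → α n k * (Σ1 k h + pow q k * Σ1 (k ∸ 1) h)) ≡ Σ1 n (λ j → h j * (α n j * ([ j ] * inv [ n ])))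
  α-abel {n} 1≤n h = begin
    Σ1 n (λ k → α n k * (Σ1 k h + pow q k * Σ1 (k ∸ 1) h))
      ≡⟨ Σ1-abel n (α n) (pow q) h ⟩
    Σ1 n (β n) * Σ1 n h - Σ1 n (λ j → h j * (Σ1 (j ∸ 1) (β n) + pow q j * α n j))
      ≡⟨ cong (_- Σ1 n (λ j → h j * (Σ1 (j ∸ 1) (β n) + pow q j * α n j))) (*-distribˡ-Σ1 n (Σ1 n (β n)) h) ⟩
    Σ1 n (λ j → Σ1 n (β n) * h j) - Σ1 n (λ j → h j * (Σ1 (j ∸ 1) (β n) + pow q j * α n j))
      ≡⟨ Σ1-distrib-- n (λ j → Σ1 n (β n) * h j) (λ j → h j * (Σ1 (j ∸ 1) (β n) + pow q j * α n j)) ⟨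
    Σ1 n (λ j → Σ1 n (β n) * h j - h j * (Σ1 (j ∸ 1) (β n) + pow q j * α n j))
      ≡⟨ Σ1-cong n term ⟩
    Σ1 n (λ j → h j * (α n j * ([ j ] * inv [ n ]))) ∎
    where
    factor-h : ∀ F H F′ p a → F * H - H * (F′ + p * a) ≡ H * ((F - F′) - p * a)
    factor-h = solve-∀ ℚ-ring
    term : ∀ j → 1 ≤ j → j ≤ n →
      Σ1 n (β n) * h j - h j * (Σ1 (j ∸ 1) (β n) + pow q j * α n j) ≡ h j * (α n j * ([ j ] * inv [ n ]))
    term j 1≤j j≤n = begin
      Σ1 n (β n) * h j - h j * (Σ1 (j ∸ 1) (β n) + pow q j * α n j)
        ≡⟨ factor-h (Σ1 n (β n)) (h j) (Σ1 (j ∸ 1) (β n)) (pow q j) (α n j) ⟩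
      h j * ((Σ1 n (β n) - Σ1 (j ∸ 1) (β n)) - pow q j * α n j)
        ≡⟨ cong (λ t → h j * (t - pow q j * α n j)) (Σβ-tail 1≤n 1≤j j≤n) ⟩
      h j * (D n j - pow q j * α n j)
        ≡⟨ cong (h j *_) (D-α 1≤n j) ⟩
      h j * (α n j * ([ j ] * inv [ n ])) ∎

  𝒯-E-cons : ∀ y T {n} → 1 ≤ n → 𝒯 n (E (y ∷ T)) ≡ inv [ n ] * 𝒯 n (λ j → [ j ] * gterm y j * E T j)
  𝒯-E-cons y T {n} 1≤n = begin
    𝒯 n (E (y ∷ T))
      ≡⟨ Σ1-cong n shifted ⟩
    Σ1 n (λ k → - (α n k * (S k + pow q k * S (k ∸ 1))))
      ≡⟨ neg-distrib-Σ1 n (λ k → α n k * (S k + pow q k * S (k ∸ 1))) ⟨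
    - Σ1 n (λ k → α n k * (S k + pow q k * S (k ∸ 1)))
      ≡⟨ cong -_ (α-abel 1≤n h) ⟩
    - Σ1 n (λ j → h j * (α n j * ([ j ] * inv [ n ])))
      ≡⟨ neg-distrib-Σ1 n (λ j → h j * (α n j * ([ j ] * inv [ n ]))) ⟩
    Σ1 n (λ j → - (h j * (α n j * ([ j ] * inv [ n ]))))
      ≡⟨ Σ1-cong n regroup ⟩
    Σ1 n (λ j → inv [ n ] * (ρ n j * ([ j ] * gterm y j * E T j)))
      ≡⟨ *-distribˡ-Σ1 n (inv [ n ]) (λ j → ρ n j * ([ j ] * gterm y j * E T j)) ⟨
    inv [ n ] * 𝒯 n (λ j → [ j ] * gterm y j * E T j) ∎
    where
    h : ℕ → ℚ
    h j = hterm q y j * Φ T j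
    S : ℕ → ℚ
    S b = Σ1 b h
    shift : ∀ r s p S′ g φ → r * - (s * ((1ℚ + p) * (S′ + g * φ))) ≡ - (r * s * ((S′ + g * (1ℚ + p) * φ) + p * S′))
    shift = solve-∀ ℚ-ring
    shifted : ∀ k → 1 ≤ k → k ≤ n → ρ n k * E (y ∷ T) k ≡ - (α n k * (S k + pow q k * S (k ∸ 1)))
    shifted (suc k) _ _ = trans
      (shift (ρ n (suc k)) (σ (suc k)) (pow q (suc k)) (S k) (gterm y (suc k)) (Φ T (suc k)))
      (cong (λ t → - (α n (suc k) * ((S k + t * Φ T (suc k)) + pow q (suc k) * S k))) (sym (hterm≡gterm* y (suc k))))
    rearrange : ∀ g p φ r s J ι → - (g * p * φ * (r * s * (J * ι))) ≡ ι * (r * (J * g * - (s * (p * φ))))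
    rearrange = solve-∀ ℚ-ring
    regroup : ∀ j → 1 ≤ j → j ≤ n →
      - (h j * (α n j * ([ j ] * inv [ n ]))) ≡ inv [ n ] * (ρ n j * ([ j ] * gterm y j * E T j))
    regroup j _ _ = trans
      (cong (λ t → - (t * Φ T j * (α n j * ([ j ] * inv [ n ])))) (hterm≡gterm* y j))
      (rearrange (gterm y j) (1ℚ + pow q j) (Φ T j) (ρ n j) (σ j) [ j ] (inv [ n ]))

  w-pow : ∀ a j → pow (w j) a ≡ pow q (a ℕ.* j) * inv (pow [ j ] (2 ℕ.* a))
  w-pow a j = begin
    pow (pow q j * inv (pow [ j ] 2)) a
      ≡⟨ pow-distrib-* (pow q j) (inv (pow [ j ] 2)) a ⟩
    pow (pow q j) a * pow (inv (pow [ j ] 2)) a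
      ≡⟨ cong₂ _*_ (sym (pow-* q j a)) (sym (inv-pow (pow [ j ] 2) a)) ⟩
    pow q (j ℕ.* a) * inv (pow (pow [ j ] 2) a)
      ≡⟨ cong₂ (λ e i → pow q e * inv i) (ℕₚ.*-comm j a) (sym (pow-* [ j ] 2 a)) ⟩
    pow q (a ℕ.* j) * inv (pow [ j ] (2 ℕ.* a)) ∎

  qint-gterm-plain : ∀ a {j} → 1 ≤ j → [ j ] * gterm (pos (2 ℕ.* a ℕ.+ 1) , a , θ) j ≡ pow (w j) a
  qint-gterm-plain a {j} 1≤j = begin
    [ j ] * (1ℚ * pow q (a ℕ.* j ℕ.+ 0) * inv (pow [ j ] (2 ℕ.* a ℕ.+ 1)))
      ≡⟨ cong (λ e → [ j ] * (1ℚ * pow q (a ℕ.* j ℕ.+ 0) * inv (pow [ j ] e))) (ℕₚ.+-comm (2 ℕ.* a) 1) ⟩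
    [ j ] * (1ℚ * pow q (a ℕ.* j ℕ.+ 0) * inv (pow [ j ] (suc (2 ℕ.* a))))
      ≡⟨ regroup [ j ] (pow q (a ℕ.* j ℕ.+ 0)) (inv (pow [ j ] (suc (2 ℕ.* a)))) ⟩
    pow q (a ℕ.* j ℕ.+ 0) * ([ j ] * inv (pow [ j ] (suc (2 ℕ.* a))))
      ≡⟨ cong₂ (λ e i → pow q e * i) (ℕₚ.+-identityʳ (a ℕ.* j)) (qint-inv-pow-suc 1≤j (2 ℕ.* a)) ⟩
    pow q (a ℕ.* j) * inv (pow [ j ] (2 ℕ.* a))
      ≡⟨ w-pow a j ⟨
    pow (w j) a ∎
    where
    regroup : ∀ k p i → k * (1ℚ * p * i) ≡ p * (k * i)
    regroup = solve-∀ ℚ-ring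

  𝒯-E-ones : ∀ d T {m} → 1 ≤ m → 𝒯 m (E (replicate d one ++ T)) ≡ inv (pow [ m ] d) * 𝒯 m (E T)
  𝒯-E-ones zero    T {m} _   = sym (ℚₚ.*-identityˡ (𝒯 m (E T)))
  𝒯-E-ones (suc d) T {m} 1≤m = begin
    𝒯 m (E (one ∷ replicate d one ++ T))
      ≡⟨ 𝒯-E-cons one (replicate d one ++ T) 1≤m ⟩
    inv [ m ] * 𝒯 m (λ j → [ j ] * gterm one j * E (replicate d one ++ T) j)
      ≡⟨ cong (inv [ m ] *_) (Σ1-cong m (λ j 1≤j _ → cong (λ t → ρ m j * (t * E (replicate d one ++ T) j))
                                                          (qint-gterm-plain 0 1≤j))) ⟩
    inv [ m ] * 𝒯 m (λ j → 1ℚ * E (replicate d one ++ T) j)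
      ≡⟨ cong (inv [ m ] *_) (Σ1-cong m (λ j _ _ → cong (ρ m j *_) (ℚₚ.*-identityˡ (E (replicate d one ++ T) j)))) ⟩
    inv [ m ] * 𝒯 m (E (replicate d one ++ T))
      ≡⟨ cong (inv [ m ] *_) (𝒯-E-ones d T 1≤m) ⟩
    inv [ m ] * (inv (pow [ m ] d) * 𝒯 m (E T))
      ≡⟨ ℚₚ.*-assoc (inv [ m ]) (inv (pow [ m ] d)) (𝒯 m (E T)) ⟨
    inv [ m ] * inv (pow [ m ] d) * 𝒯 m (E T)
      ≡⟨ cong (_* 𝒯 m (E T)) (inv-distrib-* [ m ] (pow [ m ] d)) ⟨
    inv (pow [ m ] (suc d)) * 𝒯 m (E T) ∎

  powℤ-Qe : ∀ {r} → NonNegQ r → ∀ x k → powℤ q (ℤ.+ x ℤ.+ Qe r k) ≡ pow q x * powℤ q (Qe r k)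
  powℤ-Qe nn-θ       x k = pow-+ q x 0
  powℤ-Qe (nn-suc m) x k = pow-+ q x (suc m ℕ.* tri k)

  hterm-combine : ∀ {r} → NonNegQ r → ∀ s t s′ t′ k →
    hterm q (s ⊕ pos s′ , t ℕ.+ t′ , r ⊞ θ) k ≡ hterm q (s , t , r) k * gterm (pos s′ , t′ , θ) k
  hterm-combine {r} nn s t s′ t′ k rewrite ⊞-θ r = by-sign s
    where
    regroup : ∀ ε A B Q h a b → ε * (A * B * Q) * h * (a * b) ≡ ε * (A * Q) * h * a * (1ℚ * B * b)
    regroup = solve-∀ ℚ-ring
    split : ∀ ε a →
      ε * powℤ q (ℤ.+ ((t ℕ.+ t′) ℕ.* k) ℤ.+ Qe r k) * (1ℚ + pow q k) * inv (pow [ k ] (a ℕ.+ s′))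
        ≡ ε * powℤ q (ℤ.+ (t ℕ.* k) ℤ.+ Qe r k) * (1ℚ + pow q k) * inv (pow [ k ] a)
          * (1ℚ * pow q (t′ ℕ.* k ℕ.+ 0) * inv (pow [ k ] s′))
    split ε a = begin
      ε * powℤ q (ℤ.+ ((t ℕ.+ t′) ℕ.* k) ℤ.+ Qe r k) * (1ℚ + pow q k) * inv (pow [ k ] (a ℕ.+ s′))
        ≡⟨ cong₂ (λ e i → ε * e * (1ℚ + pow q k) * i)
                 (trans (powℤ-Qe nn ((t ℕ.+ t′) ℕ.* k) k) (cong (_* powℤ q (Qe r k)) exponent))
                 (trans (cong inv (pow-+ [ k ] a s′)) (inv-distrib-* (pow [ k ] a) (pow [ k ] s′))) ⟩
      ε * (pow q (t ℕ.* k) * pow q (t′ ℕ.* k ℕ.+ 0) * powℤ q (Qe r k)) * (1ℚ + pow q k)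
        * (inv (pow [ k ] a) * inv (pow [ k ] s′))
        ≡⟨ regroup ε (pow q (t ℕ.* k)) (pow q (t′ ℕ.* k ℕ.+ 0)) (powℤ q (Qe r k)) (1ℚ + pow q k)
                   (inv (pow [ k ] a)) (inv (pow [ k ] s′)) ⟩
      ε * (pow q (t ℕ.* k) * powℤ q (Qe r k)) * (1ℚ + pow q k) * inv (pow [ k ] a)
        * (1ℚ * pow q (t′ ℕ.* k ℕ.+ 0) * inv (pow [ k ] s′))
        ≡⟨ cong (λ e → ε * e * (1ℚ + pow q k) * inv (pow [ k ] a) * (1ℚ * pow q (t′ ℕ.* k ℕ.+ 0) * inv (pow [ k ] s′)))
                (sym (powℤ-Qe nn (t ℕ.* k) k)) ⟩
      ε * powℤ q (ℤ.+ (t ℕ.* k) ℤ.+ Qe r k) * (1ℚ + pow q k) * inv (pow [ k ] a)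
        * (1ℚ * pow q (t′ ℕ.* k ℕ.+ 0) * inv (pow [ k ] s′)) ∎
      where
      exponent : pow q ((t ℕ.+ t′) ℕ.* k) ≡ pow q (t ℕ.* k) * pow q (t′ ℕ.* k ℕ.+ 0)
      exponent = trans (cong (pow q) (trans (ℕₚ.*-distribʳ-+ k t t′) (cong (t ℕ.* k ℕ.+_) (sym (ℕₚ.+-identityʳ (t′ ℕ.* k))))))
                       (pow-+ q (t ℕ.* k) (t′ ℕ.* k ℕ.+ 0))
    by-sign : ∀ s → hterm q (s ⊕ pos s′ , t ℕ.+ t′ , r) k ≡ hterm q (s , t , r) k * gterm (pos s′ , t′ , θ) k
    by-sign (pos a) = split 1ℚ a
    by-sign (bar a) = split (pow (- 1ℚ) k) a

  merge-sum : ∀ {ys} → All Plain ys → ∀ {s t r} → NonNegQ r → (ω : ℕ → ℚ) (b : ℕ) (F : List Triple → ℚ) →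
    (∀ x m → F (x ∷ m) ≡ Σ1 b (λ k → ω k * hterm q x k * Hstrict q (k ∸ 1) m)) →
    sumℚ (map F (mergesFrom (s , t , r) ys)) ≡ Σ1 b (λ k → ω k * hterm q (s , t , r) k * Φ ys k)
  merge-sum [] {s} {t} {r} nn ω b F hF = trans (ℚₚ.+-identityʳ (F ((s , t , r) ∷ []))) (hF (s , t , r) [])
  merge-sum {_ ∷ ys} (plain s′ t′ ∷ ps) {s} {t} {r} nn ω b F hF = begin
    sumℚ (map F (map (acc ∷_) (mergesFrom y ys) ++ mergesFrom (combine acc y) ys))
      ≡⟨ cong sumℚ (Listₚ.map-++ F (map (acc ∷_) (mergesFrom y ys)) (mergesFrom (combine acc y) ys)) ⟩
    sumℚ (map F (map (acc ∷_) (mergesFrom y ys)) ++ map F (mergesFrom (combine acc y) ys))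
      ≡⟨ sumℚ-++ (map F (map (acc ∷_) (mergesFrom y ys))) (map F (mergesFrom (combine acc y) ys)) ⟩
    sumℚ (map F (map (acc ∷_) (mergesFrom y ys))) + sumℚ (map F (mergesFrom (combine acc y) ys))
      ≡⟨ cong₂ _+_ separate merged ⟩
    Σ1 b (λ k → ω k * hterm q acc k * S k) + Σ1 b (λ k → ω k * (hterm q acc k * gterm y k) * Φ ys k)
      ≡⟨ Σ1-distrib-+ b (λ k → ω k * hterm q acc k * S k) (λ k → ω k * (hterm q acc k * gterm y k) * Φ ys k) ⟨
    Σ1 b (λ k → ω k * hterm q acc k * S k + ω k * (hterm q acc k * gterm y k) * Φ ys k)
      ≡⟨ Σ1-cong b (λ k _ _ → collect (ω k) (hterm q acc k) (S k) (gterm y k) (Φ ys k)) ⟩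
    Σ1 b (λ k → ω k * hterm q acc k * Φ (y ∷ ys) k) ∎
    where
    acc y : Triple
    acc = s , t , r
    y = pos s′ , t′ , θ
    S : ℕ → ℚ
    S k = Σ1 (k ∸ 1) (λ j → hterm q y j * Φ ys j)
    collect : ∀ ω h S g φ → ω * h * S + ω * (h * g) * φ ≡ ω * h * (S + g * φ)
    collect = solve-∀ ℚ-ring
    inner : ∀ b′ → sumℚ (map (Hstrict q b′) (mergesFrom y ys)) ≡ Σ1 b′ (λ j → hterm q y j * Φ ys j)
    inner b′ = trans
      (merge-sum ps nn-θ (λ _ → 1ℚ) b′ (Hstrict q b′)
        (λ x m → Σ1-cong b′ (λ j _ _ → cong (_* Hstrict q (j ∸ 1) m) (sym (ℚₚ.*-identityˡ (hterm q x j))))))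
      (Σ1-cong b′ (λ j _ _ → cong (_* Φ ys j) (ℚₚ.*-identityˡ (hterm q y j))))
    separate : sumℚ (map F (map (acc ∷_) (mergesFrom y ys))) ≡ Σ1 b (λ k → ω k * hterm q acc k * S k)
    separate = begin
      sumℚ (map F (map (acc ∷_) (mergesFrom y ys)))
        ≡⟨ cong sumℚ (trans (sym (Listₚ.map-∘ (mergesFrom y ys))) (Listₚ.map-cong (hF acc) (mergesFrom y ys))) ⟩
      sumℚ (map (λ m → Σ1 b (λ k → ω k * hterm q acc k * Hstrict q (k ∸ 1) m)) (mergesFrom y ys))
        ≡⟨ sumℚ-Σ1 b (λ k → ω k * hterm q acc k) (λ k → Hstrict q (k ∸ 1)) (mergesFrom y ys) ⟩
      Σ1 b (λ k → ω k * hterm q acc k * sumℚ (map (Hstrict q (k ∸ 1)) (mergesFrom y ys)))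
        ≡⟨ Σ1-cong b (λ k _ _ → cong (ω k * hterm q acc k *_) (inner (k ∸ 1))) ⟩
      Σ1 b (λ k → ω k * hterm q acc k * S k) ∎
    merged : sumℚ (map F (mergesFrom (combine acc y) ys)) ≡ Σ1 b (λ k → ω k * (hterm q acc k * gterm y k) * Φ ys k)
    merged = trans (merge-sum ps {s ⊕ pos s′} {t ℕ.+ t′} {r ⊞ θ} (⊞θ-nonNeg nn) ω b F hF)
      (Σ1-cong b (λ k _ _ → cong (λ u → ω k * u * Φ ys k) (hterm-combine nn s t s′ t′ k)))

  blocksCoeff : List (ℕ × ℕ) → ℕ → ℚ
  blocksCoeff []       = E []
  blocksCoeff (b ∷ bl) = λ j → w j * E (tailTriples (b ∷ bl)) j

  blockEnd-coefficient : ∀ a bl {j} → 1 ≤ j →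
    [ j ] * gterm (blockEnd a bl) j * E (tailTriples bl) j ≡ pow (w j) a * blocksCoeff bl j
  blockEnd-coefficient a []       {j} 1≤j = cong (_* E [] j) (qint-gterm-plain a 1≤j)
  blockEnd-coefficient a (b ∷ bl) {j} 1≤j = begin
    [ j ] * gterm (pos (2 ℕ.* a ℕ.+ 3) , a ℕ.+ 1 , θ) j * E T j
      ≡⟨ cong (λ e → [ j ] * gterm (pos e , a ℕ.+ 1 , θ) j * E T j) 2a+3≡2[a+1]+1 ⟩
    [ j ] * gterm (pos (2 ℕ.* (a ℕ.+ 1) ℕ.+ 1) , a ℕ.+ 1 , θ) j * E T j
      ≡⟨ cong (_* E T j) (qint-gterm-plain (a ℕ.+ 1) 1≤j) ⟩
    pow (w j) (a ℕ.+ 1) * E T j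
      ≡⟨ cong (_* E T j) (pow-+ (w j) a 1) ⟩
    pow (w j) a * (w j * 1ℚ) * E T j
      ≡⟨ regroup (pow (w j) a) (w j) (E T j) ⟩
    pow (w j) a * (w j * E T j) ∎
    where
    T : List Triple
    T = tailTriples (b ∷ bl)
    2a+3≡2[a+1]+1 : 2 ℕ.* a ℕ.+ 3 ≡ 2 ℕ.* (a ℕ.+ 1) ℕ.+ 1
    2a+3≡2[a+1]+1 = sym (trans (cong (ℕ._+ 1) (ℕₚ.*-distribˡ-+ 2 a 1)) (ℕₚ.+-assoc (2 ℕ.* a) 2 1))
    regroup : ∀ p v e → p * (v * 1ℚ) * e ≡ p * (v * e)
    regroup = solve-∀ ℚ-ring

  𝒯-E-block : ∀ d a bl {m} → 1 ≤ m →
    𝒯 m (E (replicate d one ++ blockEnd a bl ∷ tailTriples bl))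
      ≡ inv (pow [ m ] (suc d)) * 𝒯 m (λ j → pow (w j) a * blocksCoeff bl j)
  𝒯-E-block d a bl {m} 1≤m = begin
    𝒯 m (E (replicate d one ++ blockEnd a bl ∷ tailTriples bl))
      ≡⟨ 𝒯-E-ones d (blockEnd a bl ∷ tailTriples bl) 1≤m ⟩
    inv (pow [ m ] d) * 𝒯 m (E (blockEnd a bl ∷ tailTriples bl))
      ≡⟨ cong (inv (pow [ m ] d) *_) (𝒯-E-cons (blockEnd a bl) (tailTriples bl) 1≤m) ⟩
    inv (pow [ m ] d) * (inv [ m ] * 𝒯 m (λ j → [ j ] * gterm (blockEnd a bl) j * E (tailTriples bl) j))
      ≡⟨ cong (λ t → inv (pow [ m ] d) * (inv [ m ] * t))
              (Σ1-cong m (λ j 1≤j _ → cong (ρ m j *_) (blockEnd-coefficient a bl 1≤j))) ⟩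
    inv (pow [ m ] d) * (inv [ m ] * 𝒯 m (λ j → pow (w j) a * blocksCoeff bl j))
      ≡⟨ ℚₚ.*-assoc (inv (pow [ m ] d)) (inv [ m ]) _ ⟨
    inv (pow [ m ] d) * inv [ m ] * 𝒯 m (λ j → pow (w j) a * blocksCoeff bl j)
      ≡⟨ cong (_* 𝒯 m (λ j → pow (w j) a * blocksCoeff bl j))
              (trans (ℚₚ.*-comm (inv (pow [ m ] d)) (inv [ m ])) (sym (inv-distrib-* [ m ] (pow [ m ] d)))) ⟩
    inv (pow [ m ] (suc d)) * 𝒯 m (λ j → pow (w j) a * blocksCoeff bl j) ∎

  expands-blocks : ∀ bl → All (λ b → 3 ≤ proj₁ b) bl → Expands (sIndex 0 bl) (blocksCoeff bl)
  expands-blocks []             []                               = expands-nil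
  expands-blocks ((_ , a) ∷ bl) (s≤s (s≤s (s≤s {n = d} _)) ∷ h) =
    expands-cons (suc d) (expands-twos a (expands-blocks bl h)) (λ m 1≤m → sym (𝒯-E-block d a bl 1≤m))

  hterm-first : ∀ a k → hterm q (first a) k ≡ pow (w k) (suc a) * (σ k * (1ℚ + pow q k))
  hterm-first a k = begin
    pow (- 1ℚ) k * pow q ((a ℕ.+ 1) ℕ.* k ℕ.+ 1 ℕ.* tri k) * (1ℚ + pow q k) * inv (pow [ k ] (2 ℕ.* a ℕ.+ 2))
      ≡⟨ cong₂ (λ e i → pow (- 1ℚ) k * pow q e * (1ℚ + pow q k) * inv (pow [ k ] i)) exponent 2a+2≡2[1+a] ⟩
    pow (- 1ℚ) k * pow q (suc a ℕ.* k ℕ.+ tri k) * (1ℚ + pow q k) * inv (pow [ k ] (2 ℕ.* suc a))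
      ≡⟨ cong (λ t → pow (- 1ℚ) k * t * (1ℚ + pow q k) * inv (pow [ k ] (2 ℕ.* suc a))) (pow-+ q (suc a ℕ.* k) (tri k)) ⟩
    pow (- 1ℚ) k * (pow q (suc a ℕ.* k) * pow q (tri k)) * (1ℚ + pow q k) * inv (pow [ k ] (2 ℕ.* suc a))
      ≡⟨ regroup (pow (- 1ℚ) k) (pow q (suc a ℕ.* k)) (pow q (tri k)) (1ℚ + pow q k) (inv (pow [ k ] (2 ℕ.* suc a))) ⟩
    pow q (suc a ℕ.* k) * inv (pow [ k ] (2 ℕ.* suc a)) * (σ k * (1ℚ + pow q k))
      ≡⟨ cong (_* (σ k * (1ℚ + pow q k))) (w-pow (suc a) k) ⟨
    pow (w k) (suc a) * (σ k * (1ℚ + pow q k)) ∎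
    where
    exponent : (a ℕ.+ 1) ℕ.* k ℕ.+ 1 ℕ.* tri k ≡ suc a ℕ.* k ℕ.+ tri k
    exponent = cong₂ ℕ._+_ (cong (ℕ._* k) (ℕₚ.+-comm a 1)) (ℕₚ.*-identityˡ (tri k))
    2a+2≡2[1+a] : 2 ℕ.* a ℕ.+ 2 ≡ 2 ℕ.* suc a
    2a+2≡2[1+a] = sym (trans (ℕₚ.*-suc 2 a) (ℕₚ.+-comm 2 (2 ℕ.* a)))
    regroup : ∀ ε A T h i → ε * (A * T) * h * i ≡ A * i * (ε * T * h)
    regroup = solve-∀ ℚ-ring

  𝒯-first : ∀ a T {n} → 𝒯 n (λ k → pow (w k) a * (w k * E T k)) ≡ - Σ1 n (λ k → ρ n k * hterm q (first a) k * Φ T k)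
  𝒯-first a T {n} = trans
    (Σ1-cong n (λ k _ _ → trans (regroup (ρ n k) (w k) (pow (w k) a) (σ k) (1ℚ + pow q k) (Φ T k))
                               (cong (λ t → - (ρ n k * t * Φ T k)) (sym (hterm-first a k)))))
    (sym (neg-distrib-Σ1 n (λ k → ρ n k * hterm q (first a) k * Φ T k)))
    where
    regroup : ∀ r v V s p φ → r * (V * (v * - (s * (p * φ)))) ≡ - (r * (v * V * (s * p)) * φ)
    regroup = solve-∀ ℚ-ring

theorem6p1 : (q : ℚ) → 0ℚ < q → q < 1ℚ →
    (a₁ : ℕ) (blocks : List (ℕ × ℕ)) → 1 ≤ length blocks →
    All (λ b → 3 ≤ proj₁ b) blocks →
    (n : ℕ) → 1 ≤ n →
    Hstar q n (sIndex a₁ blocks) ≡ - sumℚ (map (calH q n) (Π a₁ blocks))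
theorem6p1 q 0<q q<1 a₁ blocks@(_ ∷ _) _ 3≤c n 1≤n = begin
  Hstar q n (sIndex a₁ blocks)
    ≡⟨ Expands.Hstar≡𝒯 (expands-twos a₁ (expands-blocks blocks 3≤c)) n 1≤n ⟩
  𝒯 n (λ k → pow (w k) a₁ * (w k * E T k))
    ≡⟨ 𝒯-first a₁ T {n} ⟩
  - Σ1 n (λ k → ρ n k * hterm q (first a₁) k * Φ T k)
    ≡⟨ cong -_ (merge-sum (tailTriples-plain blocks) (nn-suc 0) (ρ n) n (calH q n) (λ _ _ → refl)) ⟨
  - sumℚ (map (calH q n) (mergesFrom (first a₁) T))
    ≡⟨ cong (λ L → - sumℚ (map (calH q n) L)) (Π≡merges a₁ blocks 3≤c) ⟨
  - sumℚ (map (calH q n) (Π a₁ blocks)) ∎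
  where
  open Expansion q 0<q q<1
  T : List Triple
  T = tailTriples blocks
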